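{- Let $\eta=(\eta_1,\dots,\eta_p)$ be a composition of $n$ with positive parts and $p\ge3$. The restriction of the function $F_\eta(\gamma)=K_{\Phi(\eta)}(\gamma)$ to $Y_\eta^+$ is given by a polynomial in $\gamma_1,\dots,\gamma_{r_{p-2}}$ with rational coefficients, of degree $\sum_{1\le i<j\le p}\eta_i\eta_j-\eta_p(n-\eta_p)$.
   Context: $r_k=\eta_1+\cdots+\eta_k$, $r_0=0$. $\Phi(\eta)=\{(i,j):1\le i\le r_k<j\le n\text{ for some }k\}$; for $\gamma\in\mathbb{Z}^n$ with $\sum\gamma_i=0$, $K_{\Phi(\eta)}(\gamma)$ is the number of families $(m_{ij})_{(i,j)\in\Phi(\eta)}$ of non-negative integers with $\sum_j m_{ij}-\sum_j m_{ji}=\gamma_i$ for all $i$. $Y_\eta$ is the set of $\gamma\in\mathbb{Z}^n$ with $\sum\gamma_i=0$ such that for each $0\le k\le p-1$ and every $\Omega\subseteq\{r_k+1,\dots,r_{k+1}\}$, $\sum_{j\le r_k}\gamma_j+\sum_{a\in\Omega}\gamma_a\ge0$. $Y_\eta^+=\{\gamma\in Y_\eta:\gamma_1\ge\cdots\ge\gamma_{n-1}\ge0\}$. -}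

module Defs where

open import Data.Bool using (Bool; true; false; if_then_else_; _∧_; _∨_)
open import Data.Nat as ℕ using (ℕ; zero; suc; _∸_; _<ᵇ_; _≤ᵇ_)
open import Data.Fin as Fin using (Fin; toℕ)
open import Data.Fin.Subset using (Subset; _∈_)
open import Data.Integer as ℤ using (ℤ; +_)
open import Data.Rational as ℚ using (ℚ)
open import Data.List as List using (List; []; _∷_)
open import Data.Nat.ListAction using (sum)
open import Data.Bool.ListAction using (any)
open import Data.Vec as Vec using (Vec; []; _∷_; lookup; tabulate; toList)
open import Data.Product using (Σ; Σ-syntax; ∃; ∃-syntax; _×_; _,_)
open import Relation.Nullary.Decidable using (⌊_⌋)
open import Relation.Binary.PropositionalEquality using (_≡_; _≢_)

-- Composition data.  η = (η₁,…,η_p) is a Vec ℕ p.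
-- r η k = η₁ + ⋯ + η_k  (r η 0 = 0; for k ≥ p it is η₁+⋯+η_p).

r : ∀ {p} → Vec ℕ p → ℕ → ℕ
r η k = sum (List.take k (toList η))

pairSum : List ℕ → ℕ
pairSum []       = 0
pairSum (x ∷ xs) = x ℕ.* sum xs ℕ.+ pairSum xs

-- the degree  Σ_{i<j} η_i η_j − η_p (n − η_p), with η_p = r_p − r_{p−1}
-- and n = r_p (this quantity is always ≥ 0, so truncated ∸ is exact).
degree : ∀ {p} → Vec ℕ p → ℕ
degree {p} η = pairSum (toList η) ∸ (ηp ℕ.* (r η p ∸ ηp))
  where ηp = r η p ∸ r η (p ∸ 1)

-- Indices are 0-based: Fin n index i stands for the paper's index i+1.
-- (i,j) ∈ Φ(η)  iff  i+1 ≤ r_k < j+1 for some k ∈ {0,…,p},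
-- i.e. toℕ i < r_k ≤ toℕ j.

inΦ : ∀ {p n} → Vec ℕ p → Fin n → Fin n → Bool
inΦ {p} η i j =
  any (λ k → (toℕ i <ᵇ r η k) ∧ (r η k ≤ᵇ toℕ j)) (List.upTo (suc p))

allPairs : ∀ n → List (Fin n × Fin n)
allPairs n = List.concatMap (λ i → List.map (λ j → i , j) (List.allFin n)) (List.allFin n)

Φ : ∀ {p} → Vec ℕ p → (n : ℕ) → List (Fin n × Fin n)
Φ η n = List.filterᵇ (λ { (i , j) → inΦ η i j }) (allPairs n)

Family : ∀ {p} → Vec ℕ p → ℕ → Set
Family η n = Vec ℕ (List.length (Φ η n))

netAt : ∀ {n} → List ((Fin n × Fin n) × ℕ) → Fin n → ℤ
netAt []                    i = + 0
netAt (((a , b) , x) ∷ rest) i =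
  (if ⌊ a Fin.≟ i ⌋ then + x else + 0) ℤ.- (if ⌊ b Fin.≟ i ⌋ then + x else + 0)
  ℤ.+ netAt rest i

net : ∀ {p n} (η : Vec ℕ p) → Family η n → Vec ℤ n
net {n = n} η m = tabulate (netAt (List.zip (Φ η n) (toList m)))

KSet : ∀ {p n} → Vec ℕ p → Vec ℤ n → Set
KSet {n = n} η γ = Σ[ m ∈ Family η n ] (net η m ≡ γ)

sumℤ : ∀ {n} → (Fin n → ℤ) → ℤ
sumℤ f = Vec.foldr _ ℤ._+_ (+ 0) (tabulate f)

Y : ∀ {p n} → Vec ℕ p → Vec ℤ n → Set
Y {p} {n} η γ =
  (sumℤ (lookup γ) ≡ + 0) ×
  ((k : ℕ) → k ℕ.< p → (Ω : Subset n) →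
     ((a : Fin n) → a ∈ Ω → r η k ℕ.≤ toℕ a × toℕ a ℕ.< r η (suc k)) →
     + 0 ℤ.≤ sumℤ (λ j → if toℕ j <ᵇ r η k then lookup γ j else + 0)
             ℤ.+ sumℤ (λ a → if Vec.lookup Ω a then lookup γ a else + 0))

-- γ₁ ≥ ⋯ ≥ γ_{n−1} ≥ 0  (0-based: indices < n−1)
Y⁺ : ∀ {p n} → Vec ℕ p → Vec ℤ n → Set
Y⁺ {n = n} η γ = Y η γ ×
  ((i j : Fin n) → toℕ i ℕ.≤ toℕ j → toℕ j ℕ.< n ∸ 1 → lookup γ j ℤ.≤ lookup γ i) ×
  ((i : Fin n) → toℕ i ℕ.< n ∸ 1 → + 0 ℤ.≤ lookup γ i)

-- Polynomials in m variables with rational coefficients of degree ≤ D,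
-- given by a coefficient function on exponent vectors.

sumV : ∀ {m} → Vec ℕ m → ℕ
sumV = Vec.foldr _ ℕ._+_ 0

exps : (m D : ℕ) → List (Vec ℕ m)
exps zero    D = [] ∷ []
exps (suc m) D = List.concatMap (λ e₀ → List.map (e₀ ∷_) (exps m (D ∸ e₀))) (List.upTo (suc D))

powℚ : ℚ → ℕ → ℚ
powℚ x zero    = ℚ.1ℚ
powℚ x (suc k) = x ℚ.* powℚ x k

monomial : ∀ {m} → Vec ℕ m → (Fin m → ℚ) → ℚ
monomial {m} e x = Vec.foldr _ ℚ._*_ ℚ.1ℚ (tabulate (λ a → powℚ (x a) (lookup e a)))

-- the polynomial Σ_e c(e) x^e  (c vanishing above total degree D)
eval : ∀ {m} → (Vec ℕ m → ℚ) → ℕ → (Fin m → ℚ) → ℚ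
eval {m} c D x = List.foldr ℚ._+_ ℚ.0ℚ (List.map (λ e → c e ℚ.* monomial e x) (exps m D))

HasDegree : ∀ {m} → (Vec ℕ m → ℚ) → ℕ → Set
HasDegree c D = ((e : Vec _ _) → D ℕ.< sumV e → c e ≡ ℚ.0ℚ)
              × (∃[ e ] (sumV e ≡ D × c e ≢ ℚ.0ℚ))

-- value of coordinate a (0-based) of γ as a rational (0 if out of range)
coordℚ : ∀ {n} → Vec ℤ n → ℕ → ℚ
coordℚ {n} γ a with a ℕ.<? n
... | Relation.Nullary.Decidable.yes a<n = (lookup γ (Fin.fromℕ< a<n)) ℚ./ 1
... | Relation.Nullary.Decidable.no  _   = ℚ.0ℚ

{-# OPTIONS --safe #-}

-- K_Φ(γ) counts non-negative integer flows on the edges (i, j) of Φ(η) with net outflow γ.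
-- Fixing the flows edge by edge in lexicographic order, the flow on (i, j) ranges over
-- 0, …, (current demand of i) and moves that amount from i to j.  On Y⁺_η every vertex of
-- the last block other than n has demand 0, so edges into it carry nothing, and the last
-- edge (i, n) leaving i is forced to carry the whole remaining demand of i.  Only the inner
-- edges, between the first p − 1 blocks, contribute a genuine sum.  In the Newton basis
-- ∏ᵥ C(zᵥ, fᵥ) such a sum is again a Newton polynomial of one degree more, by
--   ∑ₓ C(zᵢ − x, F) C(zⱼ + x, G) = ∑ₐ C(zⱼ, a) C(zᵢ + 1, F + G − a + 1),
-- and only sources of inner edges, the vertices of the first p − 2 blocks, carry positive
-- exponents.  Expanding the binomials into monomials gives a polynomial of degree equal
-- to the number of inner edges, ∑_{i<j} ηᵢηⱼ − η_p(n − η_p): the coefficient of a top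
-- exponent vector f occurring in the expansion is its multiplicity times ∏ᵥ 1/fᵥ! ≠ 0.

module Submission where

open import Algebra.Bundles using (CommutativeMonoid; CommutativeSemiring)
open import Data.Nat.Base using (ℕ; suc; _≤_; _<_)
open import Data.Vec.Base as Vec using (Vec; lookup)
open import Relation.Binary.PropositionalEquality using (_≡_)

module FinSum {a ℓ} (M : CommutativeMonoid a ℓ) where
  open import Algebra.Bundles using (CommutativeMonoid)

  open import Data.Nat.Base as ℕ using (zero; suc)
  open import Data.Fin.Base using (Fin; zero; suc; toℕ; inject≤)
  open import Data.Fin.Properties using (_≟_; suc-injective)
  open import Data.Vec.Functional using (Vector; updateAt; tail)
  open import Data.Vec.Functional.Properties using (updateAt-updates; updateAt-minimal)
  open import Function.Base using (_∘_)
  open import Relation.Binary.PropositionalEquality as ≡ using (_≢_)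
  open import Relation.Nullary using (yes; no)

  open CommutativeMonoid M
  open import Algebra.Properties.CommutativeMonoid.Sum M public
  open import Algebra.Solver.CommutativeMonoid M using (solve; _⊜_; _⊕_)
  open import Relation.Binary.Reasoning.Setoid setoid

  sum-zero : ∀ {n} (t : Vector Carrier n) → (∀ i → t i ≈ ε) → sum t ≈ ε
  sum-zero {zero}  t t≈ε = refl
  sum-zero {suc n} t t≈ε = trans (∙-cong (t≈ε zero) (sum-zero (tail t) (t≈ε ∘ suc))) (identityˡ ε)

  sum-single : ∀ {n} (t : Vector Carrier n) i → (∀ j → j ≢ i → t j ≈ ε) → sum t ≈ t i
  sum-single t zero    t≈ε = trans (∙-congˡ (sum-zero (tail t) (λ j → t≈ε (suc j) λ ()))) (identityʳ (t zero))
  sum-single t (suc i) t≈ε =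
    trans (∙-cong (t≈ε zero λ ()) (sum-single (tail t) i (λ j j≢i → t≈ε (suc j) (j≢i ∘ suc-injective))))
          (identityˡ (t (suc i)))

  sum-inject≤ : ∀ {m n} (m≤n : m ℕ.≤ n) (t : Vector Carrier n) → (∀ i → m ℕ.≤ toℕ i → t i ≈ ε) →
                sum t ≈ sum (λ a → t (inject≤ a m≤n))
  sum-inject≤ {zero}          _           t t≈ε = sum-zero t (λ i → t≈ε i ℕ.z≤n)
  sum-inject≤ {suc m} {suc n} (ℕ.s≤s m≤n) t t≈ε =
    ∙-congˡ (sum-inject≤ m≤n (tail t) (λ i m≤i → t≈ε (suc i) (ℕ.s≤s m≤i)))

  without : ∀ {n} → Fin n → Vector Carrier n → Vector Carrier n
  without i t = updateAt t i (λ _ → ε)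

  sum-without : ∀ {n} (i : Fin n) t → sum t ≈ t i ∙ sum (without i t)
  sum-without zero    t = ∙-congˡ (sym (identityˡ _))
  sum-without (suc i) t = begin
    t zero ∙ sum (tail t)            ≈⟨ ∙-congˡ (sum-without i (tail t)) ⟩
    t zero ∙ (t (suc i) ∙ rest)      ≈⟨ solve 3 (λ x y z → x ⊕ (y ⊕ z) ⊜ y ⊕ (x ⊕ z)) refl (t zero) (t (suc i)) rest ⟩
    t (suc i) ∙ (t zero ∙ rest)      ∎
    where rest = sum (without i (tail t))

  without-cong : ∀ {n} (i : Fin n) {t t′ : Vector Carrier n} v →
                 (v ≢ i → t v ≈ t′ v) → without i t v ≈ without i t′ v
  without-cong i {t} {t′} v t≈t′ with v ≟ i
  ... | yes ≡.refl = reflexive (≡.trans (updateAt-updates v t) (≡.sym (updateAt-updates v t′)))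
  ... | no  v≢i    = begin
    without i t v   ≡⟨ updateAt-minimal v i t v≢i ⟩
    t v             ≈⟨ t≈t′ v≢i ⟩
    t′ v            ≡⟨ updateAt-minimal v i t′ v≢i ⟨
    without i t′ v  ∎

  sum-without₂ : ∀ {n} {i j : Fin n} → i ≢ j → ∀ t → sum t ≈ t i ∙ (t j ∙ sum (without j (without i t)))
  sum-without₂ {i = i} {j} i≢j t = begin
    sum t                            ≈⟨ sum-without i t ⟩
    t i ∙ sum (without i t)          ≈⟨ ∙-congˡ (sum-without j (without i t)) ⟩
    t i ∙ (without i t j ∙ rest)     ≡⟨ ≡.cong (λ x → t i ∙ (x ∙ rest)) (updateAt-minimal j i t (i≢j ∘ ≡.sym)) ⟩
    t i ∙ (t j ∙ rest)               ∎
    where rest = sum (without j (without i t))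

  sum-without₂-cong : ∀ {n} (i j : Fin n) {t t′ : Vector Carrier n} → (∀ v → v ≢ i → v ≢ j → t v ≈ t′ v) →
                      sum (without j (without i t)) ≈ sum (without j (without i t′))
  sum-without₂-cong i j t≈t′ =
    sum-cong-≋ (λ v → without-cong j v (λ v≢j → without-cong i v (λ v≢i → t≈t′ v v≢i v≢j)))

module ListSum {c ℓ} (R : CommutativeSemiring c ℓ) where
  open import Algebra.Bundles using (CommutativeSemiring)

  open import Level using (Level)
  open import Data.Nat.Base using (ℕ; zero; suc)
  open import Data.Fin.Base using (toℕ)
  open import Data.List.Base using (List; []; _∷_; _++_; foldr; map; concatMap; applyUpTo)
  open import Data.List.Relation.Unary.All using (All; []; _∷_)
  open import Function.Base using (_∘_)
  open import Relation.Binary.PropositionalEquality as ≡ using (_≡_)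

  open CommutativeSemiring R
  open import Algebra.Properties.CommutativeMonoid.Sum +-commutativeMonoid using (sum-syntax)
  open import Algebra.Solver.CommutativeMonoid +-commutativeMonoid using (solve; _⊜_; _⊕_)

  private variable
    a : Level
    A B : Set a

  ∑ₗ : List A → (A → Carrier) → Carrier
  ∑ₗ xs f = foldr _+_ 0# (map f xs)

  ∑ₗ-cong : ∀ (xs : List A) {f g} → All (λ x → f x ≈ g x) xs → ∑ₗ xs f ≈ ∑ₗ xs g
  ∑ₗ-cong []       []            = refl
  ∑ₗ-cong (x ∷ xs) (fx≈gx ∷ eqs) = +-cong fx≈gx (∑ₗ-cong xs eqs)

  ∑ₗ-zero : ∀ (xs : List A) {f} → All (λ x → f x ≈ 0#) xs → ∑ₗ xs f ≈ 0#
  ∑ₗ-zero []       []           = refl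
  ∑ₗ-zero (x ∷ xs) (fx≈0 ∷ zeros) = trans (+-cong fx≈0 (∑ₗ-zero xs zeros)) (+-identityˡ 0#)

  ∑ₗ-++ : ∀ (xs ys : List A) f → ∑ₗ (xs ++ ys) f ≈ ∑ₗ xs f + ∑ₗ ys f
  ∑ₗ-++ []       ys f = sym (+-identityˡ _)
  ∑ₗ-++ (x ∷ xs) ys f = trans (+-congˡ (∑ₗ-++ xs ys f)) (sym (+-assoc _ _ _))

  ∑ₗ-concatMap : ∀ (h : A → List B) xs f → ∑ₗ (concatMap h xs) f ≈ ∑ₗ xs (λ x → ∑ₗ (h x) f)
  ∑ₗ-concatMap h []       f = refl
  ∑ₗ-concatMap h (x ∷ xs) f = trans (∑ₗ-++ (h x) (concatMap h xs) f) (+-congˡ (∑ₗ-concatMap h xs f))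

  ∑ₗ-map : ∀ (h : A → B) xs f → ∑ₗ (map h xs) f ≡ ∑ₗ xs (f ∘ h)
  ∑ₗ-map h []       f = ≡.refl
  ∑ₗ-map h (x ∷ xs) f = ≡.cong (f (h x) +_) (∑ₗ-map h xs f)

  ∑ₗ-distrib-+ : ∀ (xs : List A) f g → ∑ₗ xs (λ x → f x + g x) ≈ ∑ₗ xs f + ∑ₗ xs g
  ∑ₗ-distrib-+ []       f g = sym (+-identityˡ 0#)
  ∑ₗ-distrib-+ (x ∷ xs) f g = trans (+-congˡ (∑ₗ-distrib-+ xs f g))
    (solve 4 (λ a b c d → (a ⊕ b) ⊕ (c ⊕ d) ⊜ (a ⊕ c) ⊕ (b ⊕ d)) refl (f x) (g x) _ _)

  *-distribˡ-∑ₗ : ∀ (xs : List A) f k → k * ∑ₗ xs f ≈ ∑ₗ xs (λ x → k * f x)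
  *-distribˡ-∑ₗ []       f k = zeroʳ k
  *-distribˡ-∑ₗ (x ∷ xs) f k = trans (distribˡ k (f x) _) (+-congˡ (*-distribˡ-∑ₗ xs f k))

  *-distribʳ-∑ₗ : ∀ (xs : List A) f k → ∑ₗ xs f * k ≈ ∑ₗ xs (λ x → f x * k)
  *-distribʳ-∑ₗ []       f k = zeroˡ k
  *-distribʳ-∑ₗ (x ∷ xs) f k = trans (distribʳ k (f x) _) (+-congˡ (*-distribʳ-∑ₗ xs f k))

  ∑ₗ-comm : ∀ (xs : List A) (ys : List B) (f : A → B → Carrier) →
            ∑ₗ xs (λ x → ∑ₗ ys (f x)) ≈ ∑ₗ ys (λ y → ∑ₗ xs (λ x → f x y))
  ∑ₗ-comm []       ys f = sym (∑ₗ-zero ys (allRefl ys))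
    where
    allRefl : ∀ ys → All (λ _ → 0# ≈ 0#) ys
    allRefl []       = []
    allRefl (_ ∷ ys) = refl ∷ allRefl ys
  ∑ₗ-comm (x ∷ xs) ys f = trans (+-congˡ (∑ₗ-comm xs ys f)) (sym (∑ₗ-distrib-+ ys (f x) _))

  ∑ₗ-applyUpTo : ∀ (h : ℕ → A) K f → ∑ₗ (applyUpTo h K) f ≡ ∑[ i < K ] f (h (toℕ i))
  ∑ₗ-applyUpTo h zero    f = ≡.refl
  ∑ₗ-applyUpTo h (suc K) f = ≡.cong (f (h 0) +_) (∑ₗ-applyUpTo (h ∘ suc) K f)

module BinomialIdentities where

  open import Data.Nat.Base using (ℕ; zero; suc; _+_; _*_; _∸_)
  open import Data.Nat.Properties
  open import Data.Nat.Combinatorics using (_C_; nCk+nC[k+1]≡[n+1]C[k+1]; nC1≡n)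
  open import Data.Nat.Solver using (module +-*-Solver)
  open import Data.Fin.Base using (Fin; zero; suc; toℕ)
  open import Relation.Binary.PropositionalEquality
  open FinSum +-0-commutativeMonoid using (sum; sum-syntax; sum-cong-≗; sum-zero; ∑-distrib-+; ∑-comm)
  open import Algebra.Properties.Semiring.Sum +-*-semiring using (*-distribˡ-sum)
  open +-*-Solver

  C-pascal : ∀ n k → suc n C suc k ≡ n C k + n C suc k
  C-pascal n k = sym (nCk+nC[k+1]≡[n+1]C[k+1] n k)

  vandermonde : ∀ m x k → (m + x) C k ≡ ∑[ a < suc k ] ((m C toℕ a) * (x C (k ∸ toℕ a)))
  vandermonde zero    x k       =
    sym (trans (cong₂ _+_ (+-identityʳ (x C k)) (sum-zero {k} (λ a → (0 C suc (toℕ a)) * (x C (k ∸ suc (toℕ a)))) (λ _ → refl)))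
               (+-identityʳ (x C k)))
  vandermonde (suc m) x zero    = refl
  vandermonde (suc m) x (suc k) = begin
    suc (m + x) C suc k
      ≡⟨ C-pascal (m + x) k ⟩
    (m + x) C k + (m + x) C suc k
      ≡⟨ cong₂ _+_ (vandermonde m x k) (vandermonde m x (suc k)) ⟩
    ∑[ a < suc k ] f a + ((x C suc k + 0) + ∑[ a < suc k ] g a)
      ≡⟨ solve 3 (λ s c t → s :+ ((c :+ con 0) :+ t) := (c :+ con 0) :+ (s :+ t)) refl (∑[ a < suc k ] f a) (x C suc k) _ ⟩
    (x C suc k + 0) + (∑[ a < suc k ] f a + ∑[ a < suc k ] g a)
      ≡⟨ cong (x C suc k + 0 +_) (sym (∑-distrib-+ f g)) ⟩
    (x C suc k + 0) + ∑[ a < suc k ] (f a + g a)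
      ≡⟨ cong (x C suc k + 0 +_) (sum-cong-≗ pascal-term) ⟩
    (x C suc k + 0) + ∑[ a < suc k ] ((suc m C suc (toℕ a)) * (x C (k ∸ toℕ a)))
      ∎
    where
    open ≡-Reasoning
    f g : Fin (suc k) → ℕ
    f a = (m C toℕ a) * (x C (k ∸ toℕ a))
    g a = (m C suc (toℕ a)) * (x C (k ∸ toℕ a))
    pascal-term : ∀ a → f a + g a ≡ (suc m C suc (toℕ a)) * (x C (k ∸ toℕ a))
    pascal-term a = trans (sym (*-distribʳ-+ (x C (k ∸ toℕ a)) (m C toℕ a) (m C suc (toℕ a))))
                          (cong (_* (x C (k ∸ toℕ a))) (sym (C-pascal m (toℕ a))))

  private
    0C-+ : ∀ b c → (0 C b) * (0 C c) ≡ 0 C (b + c)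
    0C-+ zero    zero    = refl
    0C-+ zero    (suc c) = refl
    0C-+ (suc b) c       = refl

  upper-vandermonde : ∀ N b c → ∑[ x < suc N ] (((N ∸ toℕ x) C b) * (toℕ x C c)) ≡ suc N C suc (b + c)
  upper-vandermonde zero b c = begin
    (0 C b) * (0 C c) + 0   ≡⟨ +-identityʳ _ ⟩
    (0 C b) * (0 C c)       ≡⟨ 0C-+ b c ⟩
    0 C (b + c)             ≡⟨ +-identityʳ _ ⟨
    0 C (b + c) + 0         ≡⟨ C-pascal 0 (b + c) ⟨
    1 C suc (b + c)         ∎
    where open ≡-Reasoning
  upper-vandermonde (suc N) b zero = begin
    (suc N C b) * 1 + ∑[ x < suc N ] (((N ∸ toℕ x) C b) * (toℕ x C 0))
      ≡⟨ cong₂ _+_ (*-identityʳ _) (upper-vandermonde N b zero) ⟩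
    suc N C b + suc N C suc (b + 0)
      ≡⟨ cong (λ b′ → suc N C b + suc N C suc b′) (+-identityʳ b) ⟩
    suc N C b + suc N C suc b
      ≡⟨ C-pascal (suc N) b ⟨
    suc (suc N) C suc b
      ≡⟨ cong (λ b′ → suc (suc N) C suc b′) (+-identityʳ b) ⟨
    suc (suc N) C suc (b + 0)
      ∎
    where open ≡-Reasoning
  upper-vandermonde (suc N) b (suc c) = begin
    (suc N C b) * 0 + ∑[ x < suc N ] (((N ∸ toℕ x) C b) * (suc (toℕ x) C suc c))
      ≡⟨ cong₂ _+_ (*-zeroʳ (suc N C b)) (sum-cong-≗ pascal-term) ⟩
    ∑[ x < suc N ] (f x + g x)
      ≡⟨ ∑-distrib-+ f g ⟩
    ∑[ x < suc N ] f x + ∑[ x < suc N ] g x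
      ≡⟨ cong₂ _+_ (upper-vandermonde N b c) (upper-vandermonde N b (suc c)) ⟩
    suc N C suc (b + c) + suc N C suc (b + suc c)
      ≡⟨ cong (λ m → suc N C suc (b + c) + suc N C suc m) (+-suc b c) ⟩
    suc N C suc (b + c) + suc N C suc (suc (b + c))
      ≡⟨ C-pascal (suc N) (suc (b + c)) ⟨
    suc (suc N) C suc (suc (b + c))
      ≡⟨ cong (λ m → suc (suc N) C suc m) (+-suc b c) ⟨
    suc (suc N) C suc (b + suc c)
      ∎
    where
    open ≡-Reasoning
    f g : Fin (suc N) → ℕ
    f x = ((N ∸ toℕ x) C b) * (toℕ x C c)
    g x = ((N ∸ toℕ x) C b) * (toℕ x C suc c)
    pascal-term : ∀ x → ((N ∸ toℕ x) C b) * (suc (toℕ x) C suc c) ≡ f x + g x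
    pascal-term x = trans (cong (((N ∸ toℕ x) C b) *_) (C-pascal (toℕ x) c)) (*-distribˡ-+ ((N ∸ toℕ x) C b) _ _)

  shift-convolution : ∀ Z F w G →
    ∑[ x < suc Z ] (((Z ∸ toℕ x) C F) * ((w + toℕ x) C G)) ≡
    ∑[ a < suc G ] ((w C toℕ a) * (Z C (F + (G ∸ toℕ a)) + Z C suc (F + (G ∸ toℕ a))))
  shift-convolution Z F w G = begin
    ∑[ x < suc Z ] (((Z ∸ toℕ x) C F) * ((w + toℕ x) C G))
      ≡⟨ sum-cong-≗ {suc Z} (λ x → cong (((Z ∸ toℕ x) C F) *_) (vandermonde w (toℕ x) G)) ⟩
    ∑[ x < suc Z ] (((Z ∸ toℕ x) C F) * ∑[ a < suc G ] ((w C toℕ a) * (toℕ x C (G ∸ toℕ a))))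
      ≡⟨ sum-cong-≗ {suc Z} (λ x → trans (*-distribˡ-sum {suc G} ((Z ∸ toℕ x) C F) (λ a → (w C toℕ a) * (toℕ x C (G ∸ toℕ a))))
                                         (sum-cong-≗ {suc G} (λ a → x*[y*z]≡y*[x*z] ((Z ∸ toℕ x) C F) (w C toℕ a)
                                                                                   (toℕ x C (G ∸ toℕ a))))) ⟩
    ∑[ x < suc Z ] ∑[ a < suc G ] summand x a
      ≡⟨ ∑-comm summand ⟩
    ∑[ a < suc G ] ∑[ x < suc Z ] summand x a
      ≡⟨ sum-cong-≗ {suc G} (λ a → sym (*-distribˡ-sum {suc Z} (w C toℕ a) (λ x → ((Z ∸ toℕ x) C F) * (toℕ x C (G ∸ toℕ a)))))
       ⟩
    ∑[ a < suc G ] ((w C toℕ a) * ∑[ x < suc Z ] (((Z ∸ toℕ x) C F) * (toℕ x C (G ∸ toℕ a))))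
      ≡⟨ sum-cong-≗ {suc G} (λ a → cong ((w C toℕ a) *_)
                                        (trans (upper-vandermonde Z F (G ∸ toℕ a)) (C-pascal Z (F + (G ∸ toℕ a))))) ⟩
    ∑[ a < suc G ] ((w C toℕ a) * (Z C (F + (G ∸ toℕ a)) + Z C suc (F + (G ∸ toℕ a))))
      ∎
    where
    open ≡-Reasoning
    summand : Fin (suc Z) → Fin (suc G) → ℕ
    summand x a = (w C toℕ a) * (((Z ∸ toℕ x) C F) * (toℕ x C (G ∸ toℕ a)))
    x*[y*z]≡y*[x*z] : ∀ x y z → x * (y * z) ≡ y * (x * z)
    x*[y*z]≡y*[x*z] = solve 3 (λ x y z → x :* (y :* z) := y :* (x :* z)) refl

  C-absorption : ∀ x k → suc k * (x C suc k) + k * (x C k) ≡ x * (x C k)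
  C-absorption x       zero    = trans (+-identityʳ _) (trans (*-identityˡ (x C 1)) (trans (nC1≡n x) (sym (*-identityʳ x))))
  C-absorption zero    (suc k) = cong₂ _+_ (*-zeroʳ (suc (suc k))) (*-zeroʳ (suc k))
  C-absorption (suc x) (suc k) = begin
    suc (suc k) * (suc x C suc (suc k)) + suc k * (suc x C suc k)
      ≡⟨ cong₂ (λ u v → suc (suc k) * u + suc k * v) (C-pascal x (suc k)) (C-pascal x k) ⟩
    suc (suc k) * (B₁ + B₂) + suc k * (B₀ + B₁)
      ≡⟨ solve 4 (λ k B₀ B₁ B₂ → (con 2 :+ k) :* (B₁ :+ B₂) :+ (con 1 :+ k) :* (B₀ :+ B₁)
                   := ((con 2 :+ k) :* B₂ :+ (con 1 :+ k) :* B₁) :+ ((con 1 :+ k) :* B₁ :+ k :* B₀) :+ (B₀ :+ B₁))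
                 refl k B₀ B₁ B₂ ⟩
    (suc (suc k) * B₂ + suc k * B₁) + (suc k * B₁ + k * B₀) + (B₀ + B₁)
      ≡⟨ cong₂ (λ u v → u + v + (B₀ + B₁)) (C-absorption x (suc k)) (C-absorption x k) ⟩
    x * B₁ + x * B₀ + (B₀ + B₁)
      ≡⟨ solve 3 (λ x B₀ B₁ → x :* B₁ :+ x :* B₀ :+ (B₀ :+ B₁) := (con 1 :+ x) :* (B₀ :+ B₁)) refl x B₀ B₁ ⟩
    suc x * (B₀ + B₁)
      ≡⟨ cong (suc x *_) (C-pascal x k) ⟨
    suc x * (suc x C suc k)
      ∎
    where
    open ≡-Reasoning
    B₀ = x C k
    B₁ = x C suc k
    B₂ = x C suc (suc k)

module NewtonBasis where

  open import Data.Nat.Base using (ℕ; zero; suc; _+_; _*_; _∸_; _≤_; z≤n)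
  open import Data.Nat.Properties
    using (*-1-commutativeMonoid; +-0-commutativeMonoid; +-*-semiring; +-assoc; +-suc; *-assoc; +-cancelʳ-≡; m∸n+n≡m; ≤-pred;
           ≤-reflexive; m≤n⇒m≤1+n)
  open import Data.Nat.Combinatorics using (_C_)
  open import Data.Nat.Solver using (module +-*-Solver)
  open import Data.Fin.Base using (Fin; zero; suc; toℕ)
  open import Data.Fin.Properties using (toℕ<n)
  open import Data.Vec.Base using (Vec; _∷_; lookup; _[_]≔_)
  open import Data.Vec.Properties using (lookup∘update; lookup∘update′)
  open import Data.Vec.Functional using (updateAt)
  open import Data.Vec.Functional.Properties using (updateAt-updates; updateAt-minimal)
  open import Data.List.Base as List using (List; []; _∷_; _++_; concat; concatMap; tabulate)
  open import Data.List.Relation.Unary.All using (All; []; _∷_; universal)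
  import Data.List.Relation.Unary.All.Properties as All
  open import Data.List.Relation.Unary.Any using (Any; here; there)
  import Data.List.Relation.Unary.Any.Properties as Any
  open import Function.Base using (_∘_)
  open import Data.Product.Base using (_×_; _,_)
  open import Data.Sum.Base using (_⊎_; inj₁; inj₂)
  open import Relation.Binary.PropositionalEquality
  open import Algebra.Properties.Semiring.Sum +-*-semiring using (*-distribʳ-sum)
  open BinomialIdentities
  open import Defs using (sumV)
  open FinSum +-0-commutativeMonoid using (sum; sum-syntax; sum-cong-≗; ∑-distrib-+; sum-zero)
  open FinSum *-1-commutativeMonoid using ()
    renaming (sum to ∏; sum-cong-≗ to ∏-cong-≗; without to without*; sum-without₂ to ∏-without₂; sum-without₂-cong to ∏-without₂-cong)
  open +-*-Solver

  module _ {n : ℕ} where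

    newton : Vec ℕ n → (Fin n → ℕ) → ℕ
    newton f z = ∏ (λ v → z v C lookup f v)

    newtonSum : List (Vec ℕ n) → (Fin n → ℕ) → ℕ
    newtonSum []      z = 0
    newtonSum (f ∷ L) z = newton f z + newtonSum L z

    newtonSum-++ : ∀ L M z → newtonSum (L ++ M) z ≡ newtonSum L z + newtonSum M z
    newtonSum-++ []      M z = refl
    newtonSum-++ (f ∷ L) M z = trans (cong (newton f z +_) (newtonSum-++ L M z)) (sym (+-assoc (newton f z) _ _))

    newtonSum-concat-tabulate : ∀ {K} (Ls : Fin K → List (Vec ℕ n)) z →
                                newtonSum (concat (tabulate Ls)) z ≡ ∑[ a < K ] newtonSum (Ls a) z
    newtonSum-concat-tabulate {zero}  Ls z = refl
    newtonSum-concat-tabulate {suc K} Ls z =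
      trans (newtonSum-++ (Ls zero) _ z) (cong (newtonSum (Ls zero) z +_) (newtonSum-concat-tabulate (Ls ∘ suc) z))

    transfer : Fin n → Fin n → ℕ → (Fin n → ℕ) → Fin n → ℕ
    transfer i j x z = updateAt (updateAt z i (_∸ x)) j (_+ x)

    -- Pascal's rule splits each term of shift-convolution in two, hence two exponent vectors per a.
    transferPair : ∀ i j (f : Vec ℕ n) → Fin (suc (lookup f j)) → List (Vec ℕ n)
    transferPair i j f a = (f [ i ]≔ c [ j ]≔ toℕ a) ∷ (f [ i ]≔ suc c [ j ]≔ toℕ a) ∷ []
      where c = lookup f i + (lookup f j ∸ toℕ a)

    transferExponents : Fin n → Fin n → Vec ℕ n → List (Vec ℕ n)
    transferExponents i j f = concat (tabulate (transferPair i j f))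

    newtonSum-cong : ∀ L {z z′ : Fin n → ℕ} → All (λ f → ∀ v → lookup f v ≡ 0 ⊎ z v ≡ z′ v) L →
                     newtonSum L z ≡ newtonSum L z′
    newtonSum-cong []      []         = refl
    newtonSum-cong (f ∷ L) {z} {z′} (same ∷ L≈) = cong₂ _+_ (∏-cong-≗ (λ v → factor v (same v))) (newtonSum-cong L L≈)
      where
      factor : ∀ v → lookup f v ≡ 0 ⊎ z v ≡ z′ v → (z v C lookup f v) ≡ (z′ v C lookup f v)
      factor v (inj₁ fv≡0)   rewrite fv≡0 = refl
      factor v (inj₂ zv≡z′v) = cong (_C lookup f v) zv≡z′v

    newtonSum-cong-≗ : ∀ L {z z′ : Fin n → ℕ} → (∀ v → z v ≡ z′ v) → newtonSum L z ≡ newtonSum L z′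
    newtonSum-cong-≗ L z≗z′ = newtonSum-cong L (universal (λ _ v → inj₂ (z≗z′ v)) L)

    rest : Fin n → Fin n → Vec ℕ n → (Fin n → ℕ) → ℕ
    rest i j f z = ∏ (without* j (without* i (λ v → z v C lookup f v)))

    module _ {i j : Fin n} (i≢j : i ≢ j) where

      newton-update₂ : ∀ f c a z → newton (f [ i ]≔ c [ j ]≔ a) z ≡ (z i C c) * ((z j C a) * rest i j f z)
      newton-update₂ f c a z = begin
        newton (f [ i ]≔ c [ j ]≔ a) z
          ≡⟨ ∏-without₂ i≢j _ ⟩
        (z i C lookup f′ i) * ((z j C lookup f′ j) * rest i j f′ z)
          ≡⟨ cong₂ (λ c′ a′ → (z i C c′) * ((z j C a′) * rest i j f′ z))
                   (trans (lookup∘update′ i≢j (f [ i ]≔ c) a) (lookup∘update i f c)) (lookup∘update j (f [ i ]≔ c) a) ⟩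
        (z i C c) * ((z j C a) * rest i j f′ z)
          ≡⟨ cong (λ r → (z i C c) * ((z j C a) * r)) (∏-without₂-cong i j unchanged) ⟩
        (z i C c) * ((z j C a) * rest i j f z)
          ∎
        where
        open ≡-Reasoning
        f′ = f [ i ]≔ c [ j ]≔ a
        unchanged : ∀ v → v ≢ i → v ≢ j → (z v C lookup f′ v) ≡ (z v C lookup f v)
        unchanged v v≢i v≢j = cong (z v C_) (trans (lookup∘update′ v≢j (f [ i ]≔ c) a) (lookup∘update′ v≢i f c))

      transfer-source : ∀ x z → transfer i j x z i ≡ z i ∸ x
      transfer-source x z = trans (updateAt-minimal i j _ i≢j) (updateAt-updates i z)

      transfer-target : ∀ x z → transfer i j x z j ≡ z j + x
      transfer-target x z = trans (updateAt-updates j (updateAt z i (_∸ x))) (cong (_+ x) (updateAt-minimal j i z (i≢j ∘ sym)))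

      transfer-other : ∀ x z v → v ≢ i → v ≢ j → transfer i j x z v ≡ z v
      transfer-other x z v v≢i v≢j = trans (updateAt-minimal v j _ v≢j) (updateAt-minimal v i z v≢i)

      newton-transfer-term : ∀ f x z →
        newton f (transfer i j x z) ≡ ((z i ∸ x) C lookup f i) * (((z j + x) C lookup f j) * rest i j f z)
      newton-transfer-term f x z = begin
        newton f z′
          ≡⟨ ∏-without₂ i≢j _ ⟩
        (z′ i C lookup f i) * ((z′ j C lookup f j) * rest i j f z′)
          ≡⟨ cong₂ (λ u w → (u C lookup f i) * ((w C lookup f j) * rest i j f z′)) (transfer-source x z) (transfer-target x z) ⟩
        ((z i ∸ x) C lookup f i) * (((z j + x) C lookup f j) * rest i j f z′)
          ≡⟨ cong (λ r → ((z i ∸ x) C lookup f i) * (((z j + x) C lookup f j) * r)) (∏-without₂-cong i j unchanged) ⟩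
        ((z i ∸ x) C lookup f i) * (((z j + x) C lookup f j) * rest i j f z)
          ∎
        where
        open ≡-Reasoning
        z′ = transfer i j x z
        unchanged : ∀ v → v ≢ i → v ≢ j → (z′ v C lookup f v) ≡ (z v C lookup f v)
        unchanged v v≢i v≢j = cong (_C lookup f v) (transfer-other x z v v≢i v≢j)

      newton-transfer : ∀ f z →
        ∑[ x < suc (z i) ] newton f (transfer i j (toℕ x) z) ≡ newtonSum (transferExponents i j f) z
      newton-transfer f z = begin
        ∑[ x < suc (z i) ] newton f (transfer i j (toℕ x) z)
          ≡⟨ sum-cong-≗ {suc (z i)} (λ x → trans (newton-transfer-term f (toℕ x) z)
                                                 (sym (*-assoc ((z i ∸ toℕ x) C lookup f i) ((z j + toℕ x) C lookup f j) R))) ⟩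
        ∑[ x < suc (z i) ] (moved x * R)
          ≡⟨ *-distribʳ-sum R moved ⟨
        (∑[ x < suc (z i) ] moved x) * R
          ≡⟨ cong (_* R) (shift-convolution (z i) (lookup f i) (z j) (lookup f j)) ⟩
        (∑[ a < suc (lookup f j) ] split a) * R
          ≡⟨ *-distribʳ-sum R split ⟩
        ∑[ a < suc (lookup f j) ] (split a * R)
          ≡⟨ sum-cong-≗ {suc (lookup f j)} (λ a → sym (pair-value a)) ⟩
        ∑[ a < suc (lookup f j) ] newtonSum (transferPair i j f a) z
          ≡⟨ newtonSum-concat-tabulate (transferPair i j f) z ⟨
        newtonSum (transferExponents i j f) z
          ∎
        where
        open ≡-Reasoning
        R = rest i j f z
        c : Fin (suc (lookup f j)) → ℕ
        c a = lookup f i + (lookup f j ∸ toℕ a)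
        moved : Fin (suc (z i)) → ℕ
        moved x = ((z i ∸ toℕ x) C lookup f i) * ((z j + toℕ x) C lookup f j)
        split : Fin (suc (lookup f j)) → ℕ
        split a = (z j C toℕ a) * (z i C c a + z i C suc (c a))
        pair-value : ∀ a → newtonSum (transferPair i j f a) z ≡ split a * R
        pair-value a = begin
          newton (f [ i ]≔ c a [ j ]≔ toℕ a) z + (newton (f [ i ]≔ suc (c a) [ j ]≔ toℕ a) z + 0)
            ≡⟨ cong₂ (λ u w → u + (w + 0)) (newton-update₂ f (c a) (toℕ a) z) (newton-update₂ f (suc (c a)) (toℕ a) z) ⟩
          (z i C c a) * ((z j C toℕ a) * R) + ((z i C suc (c a)) * ((z j C toℕ a) * R) + 0)
            ≡⟨ solve 4 (λ p q b r → p :* (b :* r) :+ (q :* (b :* r) :+ con 0) := b :* (p :+ q) :* r) refl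
                       (z i C c a) (z i C suc (c a)) (z j C toℕ a) R ⟩
          split a * R
            ∎

      newtonSum-transfer : ∀ L z →
        ∑[ x < suc (z i) ] newtonSum L (transfer i j (toℕ x) z) ≡ newtonSum (concatMap (transferExponents i j) L) z
      newtonSum-transfer []      z = sum-zero {suc (z i)} (λ _ → 0) (λ _ → refl)
      newtonSum-transfer (f ∷ L) z = begin
        ∑[ x < suc (z i) ] (newton f (z′ x) + newtonSum L (z′ x))
          ≡⟨ ∑-distrib-+ (λ x → newton f (z′ x)) (λ x → newtonSum L (z′ x)) ⟩
        ∑[ x < suc (z i) ] newton f (z′ x) + ∑[ x < suc (z i) ] newtonSum L (z′ x)
          ≡⟨ cong₂ _+_ (newton-transfer f z) (newtonSum-transfer L z) ⟩
        newtonSum (transferExponents i j f) z + newtonSum (concatMap (transferExponents i j) L) z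
          ≡⟨ newtonSum-++ (transferExponents i j f) _ z ⟨
        newtonSum (concatMap (transferExponents i j) (f ∷ L)) z
          ∎
        where
        open ≡-Reasoning
        z′ : Fin (suc (z i)) → Fin n → ℕ
        z′ x = transfer i j (toℕ x) z

  sumV-update : ∀ {n} (f : Vec ℕ n) i y → sumV (f [ i ]≔ y) + lookup f i ≡ sumV f + y
  sumV-update (x ∷ f) zero    y = solve 3 (λ x s y → y :+ s :+ x := x :+ s :+ y) refl x (sumV f) y
  sumV-update (x ∷ f) (suc i) y = trans (+-assoc x _ _) (trans (cong (x +_) (sumV-update f i y)) (sym (+-assoc x _ y)))

  module _ {n} {i j : Fin n} (i≢j : i ≢ j) (f : Vec ℕ n) where

    sumV-update₂ : ∀ c a → sumV (f [ i ]≔ c [ j ]≔ a) + (lookup f i + lookup f j) ≡ sumV f + (c + a)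
    sumV-update₂ c a = begin
      sumV (f [ i ]≔ c [ j ]≔ a) + (lookup f i + lookup f j)
        ≡⟨ cong (λ y → sumV (f [ i ]≔ c [ j ]≔ a) + (lookup f i + y)) (lookup∘update′ (i≢j ∘ sym) f c) ⟨
      sumV (f [ i ]≔ c [ j ]≔ a) + (lookup f i + lookup (f [ i ]≔ c) j)
        ≡⟨ solve 3 (λ s x y → s :+ (x :+ y) := (s :+ y) :+ x) refl (sumV (f [ i ]≔ c [ j ]≔ a)) (lookup f i) _ ⟩
      (sumV (f [ i ]≔ c [ j ]≔ a) + lookup (f [ i ]≔ c) j) + lookup f i
        ≡⟨ cong (_+ lookup f i) (sumV-update (f [ i ]≔ c) j a) ⟩
      (sumV (f [ i ]≔ c) + a) + lookup f i
        ≡⟨ solve 3 (λ s a x → (s :+ a) :+ x := (s :+ x) :+ a) refl (sumV (f [ i ]≔ c)) a (lookup f i) ⟩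
      (sumV (f [ i ]≔ c) + lookup f i) + a
        ≡⟨ cong (_+ a) (sumV-update f i c) ⟩
      (sumV f + c) + a
        ≡⟨ +-assoc (sumV f) c a ⟩
      sumV f + (c + a)
        ∎
      where open ≡-Reasoning

    private
      balanced : ∀ a → a ≤ lookup f j → (lookup f i + (lookup f j ∸ a)) + a ≡ lookup f i + lookup f j
      balanced a a≤ = trans (+-assoc (lookup f i) _ a) (cong (lookup f i +_) (m∸n+n≡m a≤))

      size : ∀ c a → c + a ≡ lookup f i + lookup f j → sumV (f [ i ]≔ c [ j ]≔ a) ≡ sumV f
      size c a eq = +-cancelʳ-≡ (lookup f i + lookup f j) _ _
        (trans (sumV-update₂ c a) (cong (sumV f +_) eq))

      size-suc : ∀ c a → c + a ≡ lookup f i + lookup f j → sumV (f [ i ]≔ suc c [ j ]≔ a) ≡ suc (sumV f)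
      size-suc c a eq = +-cancelʳ-≡ (lookup f i + lookup f j) _ _
        (trans (sumV-update₂ (suc c) a) (trans (+-suc (sumV f) (c + a)) (cong (λ s → suc (sumV f + s)) eq)))

    transferExponents-bounded : All (λ g → sumV g ≤ suc (sumV f)) (transferExponents i j f)
    transferExponents-bounded = All.concat⁺ (All.tabulate⁺ {f = transferPair i j f} λ a →
      let eq = balanced (toℕ a) (≤-pred (toℕ<n a)) in
      m≤n⇒m≤1+n (≤-reflexive (size (c a) (toℕ a) eq)) ∷ ≤-reflexive (size-suc (c a) (toℕ a) eq) ∷ [])
      where
      c : Fin (suc (lookup f j)) → ℕ
      c a = lookup f i + (lookup f j ∸ toℕ a)

    transferExponents-reaches : Any (λ g → sumV g ≡ suc (sumV f)) (transferExponents i j f)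
    transferExponents-reaches =
      Any.++⁺ˡ {xs = transferPair i j f zero} (there (here (size-suc (lookup f i + (lookup f j ∸ 0)) 0 (balanced 0 z≤n))))

    transferExponents-shape :
      All (λ g → lookup g j ≤ lookup f j × (∀ v → v ≢ i → v ≢ j → lookup g v ≡ lookup f v)) (transferExponents i j f)
    transferExponents-shape = All.concat⁺ (All.tabulate⁺ {f = transferPair i j f} λ a → shape _ a ∷ shape _ a ∷ [])
      where
      shape : ∀ c a → lookup (f [ i ]≔ c [ j ]≔ toℕ a) j ≤ lookup f j ×
                      (∀ v → v ≢ i → v ≢ j → lookup (f [ i ]≔ c [ j ]≔ toℕ a) v ≡ lookup f v)
      shape c a = subst (_≤ lookup f j) (sym (lookup∘update j (f [ i ]≔ c) (toℕ a))) (≤-pred (toℕ<n a))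
                , λ v v≢i v≢j → trans (lookup∘update′ v≢j (f [ i ]≔ c) (toℕ a)) (lookup∘update′ v≢i f c)

module Flows where

  open import Data.Nat.Base as ℕ using (ℕ; zero; suc; z≤n; s≤s)
  import Data.Nat.Properties as ℕ
  open import Data.Integer.Base as ℤ using (ℤ; +_; _+_; _-_; -_; +≤+)
  import Data.Integer.Properties as ℤ
  open import Data.Integer.Solver using (module +-*-Solver)
  open import Data.Fin.Base using (Fin; zero; suc; toℕ)
  import Data.Fin.Properties as Fin
  open import Data.Vec.Base using (Vec; []; _∷_; lookup; tabulate; toList)
  open import Data.Vec.Properties using (lookup∘tabulate; tabulate-cong; tabulate∘lookup; ≡-dec)
  open import Data.List.Base using (List; []; _∷_; length; zip)
  open import Data.List.Relation.Unary.All using (All; []; _∷_)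
  open import Data.List.Relation.Unary.Any using (Any; here; there)
  open import Data.Product.Base using (Σ; Σ-syntax; _×_; _,_; proj₁; proj₂)
  open import Data.Sum.Base using (_⊎_; inj₁; inj₂)
  open import Data.Sum.Function.Propositional using (_⊎-↔_)
  open import Data.Unit.Base using (⊤)
  open import Data.Empty using (⊥; ⊥-elim)
  open import Data.Bool.Base using (true; false; if_then_else_)
  open import Relation.Nullary using (yes; no; ¬_)
  open import Relation.Nullary.Decidable using (⌊_⌋; isYes≗does; dec-true; dec-false)
  open import Relation.Binary.PropositionalEquality
  open import Function.Base using (_∘_)
  open import Function.Bundles using (_↔_; mk↔ₛ′; Inverse)
  open import Function.Properties.Inverse using (↔-trans; ↔-sym)
  open import Axiom.UniquenessOfIdentityProofs using (module Decidable⇒UIP)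
  open import Defs using (netAt)
  open FinSum ℕ.+-0-commutativeMonoid using (sum; sum-syntax)
  module ℤΣ = FinSum ℤ.+-0-commutativeMonoid
  open +-*-Solver

  Edges : ℕ → Set
  Edges n = List (Fin n × Fin n)

  choices : ℤ → ℕ
  choices (+ k)      = suc k
  choices ℤ.-[1+ k ] = 0

  private
    ≡-irrelevant : ∀ {n} {u v : Vec ℤ n} (p q : u ≡ v) → p ≡ q
    ≡-irrelevant = Decidable⇒UIP.≡-irrelevant (≡-dec ℤ._≟_)

  module _ {n : ℕ} where

    -- KSet η γ is Flows (Φ η n) γ by definition.
    Flows : Edges n → Vec ℤ n → Set
    Flows E γ = Σ[ m ∈ Vec ℕ (length E) ] (tabulate (netAt (zip E (toList m))) ≡ γ)

    -- Literally the summand of netAt, so that netAt on a cons unfolds to edgeNet.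
    edgeNet : Fin n → Fin n → ℕ → Fin n → ℤ
    edgeNet a b x v = (if ⌊ a Fin.≟ v ⌋ then + x else + 0) - (if ⌊ b Fin.≟ v ⌋ then + x else + 0)

    residual : Vec ℤ n → Fin n → Fin n → ℕ → Vec ℤ n
    residual γ a b x = tabulate (λ v → lookup γ v - edgeNet a b x v)

    flowCount : Edges n → Vec ℤ n → ℕ
    flowCount []             γ with ≡-dec ℤ._≟_ (tabulate (λ _ → + 0)) γ
    ... | yes _ = 1
    ... | no  _ = 0
    flowCount ((a , b) ∷ E) γ = ∑[ x < choices (lookup γ a) ] flowCount E (residual γ a b (toℕ x))

    SourcesFirst : Edges n → Set
    SourcesFirst []            = ⊤
    SourcesFirst ((a , b) ∷ E) = a ≢ b × All (λ e → proj₂ e ≢ a) E × SourcesFirst E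

    tabulate-≡⁻ : ∀ (f : Fin n → ℤ) {γ} → tabulate f ≡ γ → ∀ v → f v ≡ lookup γ v
    tabulate-≡⁻ f refl v = sym (lookup∘tabulate f v)

    tabulate-≡⁺ : ∀ {f : Fin n → ℤ} {γ} → (∀ v → f v ≡ lookup γ v) → tabulate f ≡ γ
    tabulate-≡⁺ {γ = γ} eq = trans (tabulate-cong eq) (tabulate∘lookup γ)

    private
      lookup-residual : ∀ γ a b x v → lookup (residual γ a b x) v ≡ lookup γ v - edgeNet a b x v
      lookup-residual γ a b x v = lookup∘tabulate _ v

      move-left : ∀ (c N g : ℤ) → c + N ≡ g → N ≡ g - c
      move-left c N g refl = solve 2 (λ c N → N := (c :+ N) :- c) refl c N

      move-right : ∀ (c N g : ℤ) → N ≡ g - c → c + N ≡ g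
      move-right c N g refl = solve 2 (λ c g → c :+ (g :- c) := g) refl c g

    Flows-step : ∀ a b E γ → Flows ((a , b) ∷ E) γ ↔ Σ ℕ (λ x → Flows E (residual γ a b x))
    Flows-step a b E γ = mk↔ₛ′ to from (λ { (x , m , q) → cong (λ q′ → x , m , q′) (≡-irrelevant _ _) })
                                       (λ { (x ∷ m , p) → cong (λ p′ → x ∷ m , p′) (≡-irrelevant _ _) })
      where
      to : Flows ((a , b) ∷ E) γ → Σ ℕ (λ x → Flows E (residual γ a b x))
      to (x ∷ m , p) = x , m , tabulate-≡⁺ λ v →
        trans (move-left _ _ _ (tabulate-≡⁻ _ p v)) (sym (lookup-residual γ a b x v))
      from : Σ ℕ (λ x → Flows E (residual γ a b x)) → Flows ((a , b) ∷ E) γ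
      from (x , m , q) = x ∷ m , tabulate-≡⁺ λ v →
        move-right _ _ _ (trans (tabulate-≡⁻ _ q v) (lookup-residual γ a b x v))

    _∈ₛ_ : Fin n → Edges n → Set
    v ∈ₛ E = Any (λ e → proj₁ e ≡ v) E

    private
      ⌊≟⌋-refl : ∀ (v : Fin n) → ⌊ v Fin.≟ v ⌋ ≡ true
      ⌊≟⌋-refl v = trans (isYes≗does (v Fin.≟ v)) (dec-true (v Fin.≟ v) refl)

      ⌊≟⌋-≢ : ∀ {u v : Fin n} → u ≢ v → ⌊ u Fin.≟ v ⌋ ≡ false
      ⌊≟⌋-≢ {u} {v} u≢v = trans (isYes≗does (u Fin.≟ v)) (dec-false (u Fin.≟ v) u≢v)

      indicator-nonneg : ∀ t x → + 0 ℤ.≤ (if t then + x else + 0)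
      indicator-nonneg true  x = +≤+ z≤n
      indicator-nonneg false x = +≤+ z≤n

    module _ {a b : Fin n} (x : ℕ) where

      edgeNet-source : a ≢ b → edgeNet a b x a ≡ + x
      edgeNet-source a≢b rewrite ⌊≟⌋-refl a | ⌊≟⌋-≢ (a≢b ∘ sym) = ℤ.+-identityʳ (+ x)

      edgeNet-target : a ≢ b → edgeNet a b x b ≡ - + x
      edgeNet-target a≢b rewrite ⌊≟⌋-≢ a≢b | ⌊≟⌋-refl b = ℤ.+-identityˡ (- + x)

      edgeNet-other : ∀ v → v ≢ a → v ≢ b → edgeNet a b x v ≡ + 0
      edgeNet-other v v≢a v≢b rewrite ⌊≟⌋-≢ (v≢a ∘ sym) | ⌊≟⌋-≢ (v≢b ∘ sym) = refl

      edgeNet-nonneg : ∀ v → b ≢ v → + 0 ℤ.≤ edgeNet a b x v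
      edgeNet-nonneg v b≢v rewrite ⌊≟⌋-≢ b≢v =
        subst (+ 0 ℤ.≤_) (sym (ℤ.+-identityʳ _)) (indicator-nonneg ⌊ a Fin.≟ v ⌋ x)

    module _ (γ : Vec ℤ n) {a b : Fin n} (x : ℕ) where

      residual-source : a ≢ b → lookup (residual γ a b x) a ≡ lookup γ a - + x
      residual-source a≢b =
        trans (lookup-residual γ a b x a) (cong (λ t → lookup γ a - t) (edgeNet-source x a≢b))

      residual-target : a ≢ b → lookup (residual γ a b x) b ≡ lookup γ b + + x
      residual-target a≢b =
        trans (lookup-residual γ a b x b) (trans (cong (λ t → lookup γ b - t) (edgeNet-target x a≢b))
                                                 (cong (λ t → lookup γ b + t) (ℤ.neg-involutive (+ x))))

      residual-other : ∀ v → v ≢ a → v ≢ b → lookup (residual γ a b x) v ≡ lookup γ v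
      residual-other v v≢a v≢b =
        trans (lookup-residual γ a b x v) (trans (cong (λ t → lookup γ v - t) (edgeNet-other x v v≢a v≢b))
                                                 (ℤ.+-identityʳ (lookup γ v)))

    residual-zero : ∀ γ (a b : Fin n) → residual γ a b 0 ≡ γ
    residual-zero γ a b = tabulate-≡⁺ λ v →
      trans (cong (λ t → lookup γ v - t) (no-flow ⌊ a Fin.≟ v ⌋ ⌊ b Fin.≟ v ⌋)) (ℤ.+-identityʳ (lookup γ v))
      where
      no-flow : ∀ s t → (if s then + 0 else + 0) - (if t then + 0 else + 0) ≡ + 0
      no-flow true  true  = refl
      no-flow true  false = refl
      no-flow false true  = refl
      no-flow false false = refl

    netAt-nonneg : ∀ v E ms → All (λ e → proj₂ e ≢ v) E → + 0 ℤ.≤ netAt (zip E ms) v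
    netAt-nonneg v []            ms       _           = +≤+ z≤n
    netAt-nonneg v (_ ∷ _)       []       _           = +≤+ z≤n
    netAt-nonneg v ((a , b) ∷ E) (x ∷ ms) (b≢v ∷ E≢v) =
      ℤ.+-mono-≤ (edgeNet-nonneg {a} x v b≢v) (netAt-nonneg v E ms E≢v)

    netAt-nonpos : ∀ v E ms → ¬ v ∈ₛ E → netAt (zip E ms) v ℤ.≤ + 0
    netAt-nonpos v []            ms       _   = +≤+ z≤n
    netAt-nonpos v (_ ∷ _)       []       _   = +≤+ z≤n
    netAt-nonpos v ((a , b) ∷ E) (x ∷ ms) v∉E rewrite ⌊≟⌋-≢ (v∉E ∘ here) =
      ℤ.+-mono-≤ (outflow ⌊ b Fin.≟ v ⌋) (netAt-nonpos v E ms (v∉E ∘ there))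
      where
      outflow : ∀ t → + 0 - (if t then + x else + 0) ℤ.≤ + 0
      outflow true  = ℤ.≤-trans (ℤ.≤-reflexive (ℤ.+-identityˡ (- + x))) (ℤ.neg-mono-≤ (+≤+ z≤n))
      outflow false = +≤+ z≤n

    netAt-zero : ∀ v E ms → ¬ v ∈ₛ E → All (λ e → proj₂ e ≢ v) E → netAt (zip E ms) v ≡ + 0
    netAt-zero v E ms v∉E E≢v = ℤ.≤-antisym (netAt-nonpos v E ms v∉E) (netAt-nonneg v E ms E≢v)

    Flows-bound : ∀ {a b} E γ → a ≢ b → All (λ e → proj₂ e ≢ a) E →
                  ∀ x → Flows E (residual γ a b x) → x ℕ.< choices (lookup γ a)
    Flows-bound {a} {b} E γ a≢b E≢a x (m , q) = <choices (lookup γ a) x≤γa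
      where
      net≡ : netAt (zip E (toList m)) a ≡ lookup γ a - + x
      net≡ = trans (tabulate-≡⁻ _ q a) (residual-source γ x a≢b)
      x≤γa : + x ℤ.≤ lookup γ a
      x≤γa = ℤ.0≤i-j⇒j≤i (subst (+ 0 ℤ.≤_) net≡ (netAt-nonneg a E (toList m) E≢a))
      <choices : ∀ g → + x ℤ.≤ g → x ℕ.< choices g
      <choices (+ k) (+≤+ x≤k) = s≤s x≤k

  Σℕ↔Fin-sum : ∀ K (A : ℕ → Set) (f : ℕ → ℕ) → (∀ x → A x ↔ Fin (f x)) → (∀ x → A x → x ℕ.< K) →
               Σ ℕ A ↔ Fin (∑[ x < K ] f (toℕ x))
  Σℕ↔Fin-sum zero    A f A↔f bound = mk↔ₛ′ (⊥-elim ∘ empty) (λ ()) (λ ()) (⊥-elim ∘ empty)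
    where
    empty : Σ ℕ A → ⊥
    empty (x , a) = ℕ.n≮0 (bound x a)
  Σℕ↔Fin-sum (suc K) A f A↔f bound =
    ↔-trans Σℕ↔⊎ (↔-trans (A↔f 0 ⊎-↔ Σℕ↔Fin-sum K (A ∘ suc) (f ∘ suc) (A↔f ∘ suc) bound′) (↔-sym Fin.+↔⊎))
    where
    bound′ : ∀ x → A (suc x) → x ℕ.< K
    bound′ x a = ℕ.≤-pred (bound (suc x) a)
    Σℕ↔⊎ : Σ ℕ A ↔ (A 0 ⊎ Σ ℕ (A ∘ suc))
    Σℕ↔⊎ = mk↔ₛ′ (λ { (zero , a) → inj₁ a ; (suc x , a) → inj₂ (x , a) })
                 (λ { (inj₁ a) → zero , a ; (inj₂ (x , a)) → suc x , a })
                 (λ { (inj₁ a) → refl ; (inj₂ (x , a)) → refl })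
                 (λ { (zero , a) → refl ; (suc x , a) → refl })

  Flows↔Fin-flowCount : ∀ {n} (E : Edges n) → SourcesFirst E → ∀ γ → Flows E γ ↔ Fin (flowCount E γ)
  Flows↔Fin-flowCount {n} [] _ γ with ≡-dec ℤ._≟_ (tabulate (λ _ → + 0)) γ
  ... | yes γ≡0 = mk↔ₛ′ (λ _ → zero) (λ _ → [] , γ≡0) (λ { zero → refl })
                       (λ { ([] , q) → cong ([] ,_) (≡-irrelevant γ≡0 q) })
  ... | no  γ≢0 = mk↔ₛ′ (λ { ([] , q) → ⊥-elim (γ≢0 q) }) (λ ()) (λ ()) (λ { ([] , q) → ⊥-elim (γ≢0 q) })
  Flows↔Fin-flowCount ((a , b) ∷ E) (a≢b , E≢a , sf) γ =
    ↔-trans (Flows-step a b E γ)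
            (Σℕ↔Fin-sum (choices (lookup γ a)) (λ x → Flows E (residual γ a b x)) (λ x → flowCount E (residual γ a b x))
                        (Flows↔Fin-flowCount E sf ∘ residual γ a b) (Flows-bound E γ a≢b E≢a))

  ¬Flows⇒flowCount≡0 : ∀ {n} (E : Edges n) → SourcesFirst E → ∀ γ → ¬ Flows E γ → flowCount E γ ≡ 0
  ¬Flows⇒flowCount≡0 E sf γ ¬flow with flowCount E γ | Flows↔Fin-flowCount E sf γ
  ... | zero  | _      = refl
  ... | suc _ | flow↔ = ⊥-elim (¬flow (Inverse.from flow↔ zero))

  sum-residual : ∀ {n} (γ : Vec ℤ n) {a b} x → a ≢ b → ℤΣ.sum (lookup (residual γ a b x)) ≡ ℤΣ.sum (lookup γ)
  sum-residual {n} γ {a} {b} x a≢b = begin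
    ℤΣ.sum (lookup γ′)
      ≡⟨ ℤΣ.sum-without₂ a≢b (lookup γ′) ⟩
    lookup γ′ a + (lookup γ′ b + rest (lookup γ′))
      ≡⟨ cong₂ (λ s t → s + (t + rest (lookup γ′))) (residual-source γ x a≢b) (residual-target γ x a≢b) ⟩
    (lookup γ a - + x) + ((lookup γ b + + x) + rest (lookup γ′))
      ≡⟨ cong (λ r → (lookup γ a - + x) + ((lookup γ b + + x) + r)) (ℤΣ.sum-without₂-cong a b (residual-other γ x)) ⟩
    (lookup γ a - + x) + ((lookup γ b + + x) + rest (lookup γ))
      ≡⟨ solve 4 (λ p q y r → (p :- y) :+ ((q :+ y) :+ r) := p :+ (q :+ r)) refl (lookup γ a) (lookup γ b) (+ x) _ ⟩
    lookup γ a + (lookup γ b + rest (lookup γ))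
      ≡⟨ ℤΣ.sum-without₂ a≢b (lookup γ) ⟨
    ℤΣ.sum (lookup γ)
      ∎
    where
    open ≡-Reasoning
    γ′ = residual γ a b x
    rest : (Fin n → ℤ) → ℤ
    rest t = ℤΣ.sum (ℤΣ.without b (ℤΣ.without a t))

module FlowCounting (n′ R S : ℕ) (R≤S : R ≤ S) (S≤n′ : S ≤ n′) where
  open import Data.Nat.Base as ℕ using (ℕ; zero; suc; _∸_; _≤_; _<_; z≤n; s≤s)

  import Data.Nat.Properties as ℕ
  open import Data.Integer.Base as ℤ using (ℤ; +_; ∣_∣; _+_; _-_; +≤+)
  import Data.Integer.Properties as ℤ
  open import Data.Fin.Base using (Fin; toℕ; fromℕ)
  import Data.Fin.Properties as Fin
  open import Data.Vec.Base using (Vec; lookup; replicate; tabulate; toList)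
  open import Data.Vec.Properties using (lookup-replicate; ≡-dec)
  open import Data.List.Base using (List; []; _∷_; concatMap; zip)
  open import Data.List.Relation.Unary.All as All using (All; []; _∷_)
  import Data.List.Relation.Unary.All.Properties as All
  open import Data.List.Relation.Unary.Any as Any using (Any; here; there)
  import Data.List.Relation.Unary.Any.Properties as Any
  open import Data.Product.Base using (_×_; _,_; proj₁; proj₂)
  open import Data.Sum.Base using (_⊎_; inj₁; inj₂; [_,_]′)
  open import Data.Unit.Base using (⊤; tt)
  open import Data.Empty using (⊥-elim)
  open import Function.Base using (_∘_)
  open import Relation.Nullary using (yes; no; ¬_)
  open import Relation.Nullary.Decidable using (⌊_⌋)
  open import Data.Bool.Base using (Bool; if_then_else_)
  open import Relation.Binary.PropositionalEquality
  open import Defs using (sumV; netAt)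
  open NewtonBasis
  open Flows
  open FinSum ℕ.+-0-commutativeMonoid using (sum; sum-syntax; sum-cong-≗; sum-single)
  open FinSum ℕ.*-1-commutativeMonoid using () renaming (sum-zero to ∏-zero)
  open import Data.Nat.Combinatorics using (_C_)

  -- Vertices are 0, …, n′ and n′ is the sink.  In the application S and R are the first
  -- vertices of the last and of the second-to-last block.
  n : ℕ
  n = suc n′

  sink : Fin n
  sink = fromℕ n′

  below-or-sink : ∀ v → toℕ v < n′ ⊎ v ≡ sink
  below-or-sink v with toℕ v ℕ.<? n′
  ... | yes v<n′ = inj₁ v<n′
  ... | no  v≮n′ = inj₂ (Fin.toℕ-injective (trans (ℕ.≤-antisym (ℕ.≤-pred (Fin.toℕ<n v)) (ℕ.≮⇒≥ v≮n′))
                                                  (sym (Fin.toℕ-fromℕ n′))))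

  ≢sink⇒<n′ : ∀ {v} → v ≢ sink → toℕ v < n′
  ≢sink⇒<n′ {v} v≢sink with below-or-sink v
  ... | inj₁ v<n′   = v<n′
  ... | inj₂ v≡sink = ⊥-elim (v≢sink v≡sink)

  <n′⇒≢sink : ∀ {v} → toℕ v < n′ → v ≢ sink
  <n′⇒≢sink v<n′ refl = ℕ.<-irrefl (Fin.toℕ-fromℕ n′) v<n′

  private
    ∉ₛ⇒≢ : ∀ {u v} {E : Edges n} → u ∈ₛ E → ¬ v ∈ₛ E → v ≢ u
    ∉ₛ⇒≢ u∈E v∉E refl = v∉E u∈E

    ∉ₛ-∷ : ∀ {i j v} {E : Edges n} → v ≢ i → ¬ v ∈ₛ E → ¬ v ∈ₛ ((i , j) ∷ E)
    ∉ₛ-∷ v≢i _   (here i≡v)  = v≢i (sym i≡v)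
    ∉ₛ-∷ _   v∉E (there v∈E) = v∉E v∈E

  record EdgeFacts (i j : Fin n) (E : Edges n) : Set where
    field
      forward      : toℕ i < toℕ j
      source-fresh : All (λ e → proj₂ e ≢ i) E
      inner        : toℕ j < S → i ∈ₛ E × j ∈ₛ E × toℕ i < R
      dead-end     : S ≤ toℕ j → toℕ j < n′ → i ∈ₛ E × ¬ j ∈ₛ E
      into-sink    : j ≡ sink → ¬ i ∈ₛ E

    distinct : i ≢ j
    distinct i≡j = ℕ.<-irrefl (cong toℕ i≡j) forward

  Admissible : Edges n → Set
  Admissible []            = ⊤
  Admissible ((i , j) ∷ E) = EdgeFacts i j E × Admissible E

  Admissible⇒SourcesFirst : ∀ E → Admissible E → SourcesFirst E
  Admissible⇒SourcesFirst []            _           = tt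
  Admissible⇒SourcesFirst ((i , j) ∷ E) (facts , adm) =
    EdgeFacts.distinct facts , EdgeFacts.source-fresh facts , Admissible⇒SourcesFirst E adm

  record Invariant (E : Edges n) (γ : Vec ℤ n) : Set where
    field
      nonneg   : ∀ v → toℕ v < n′ → + 0 ℤ.≤ lookup γ v
      idle     : ∀ v → toℕ v < n′ → ¬ v ∈ₛ E → lookup γ v ≡ + 0
      balanced : ℤΣ.sum (lookup γ) ≡ + 0

  𝟙 : Bool → ℕ
  𝟙 b = if b then 1 else 0

  count : ∀ {A : Set} → (A → Bool) → List A → ℕ
  count P []       = 0
  count P (x ∷ xs) = 𝟙 (P x) ℕ.+ count P xs

  isInner : Fin n × Fin n → Bool
  isInner (i , j) = ⌊ toℕ j ℕ.<? S ⌋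

  innerEdges : Edges n → ℕ
  innerEdges = count isInner

  newtonExponents : Edges n → List (Vec ℕ n)
  newtonExponents []            = replicate n 0 ∷ []
  newtonExponents ((i , j) ∷ E) with toℕ j ℕ.<? S
  ... | yes _ = concatMap (transferExponents i j) (newtonExponents E)
  ... | no  _ = newtonExponents E

  ∣_∣ⱽ : Vec ℤ n → Fin n → ℕ
  ∣ γ ∣ⱽ v = ∣ lookup γ v ∣

  CountedBy : Edges n → List (Vec ℕ n) → Set
  CountedBy E L = ∀ γ → Invariant E γ → flowCount E γ ≡ newtonSum L ∣ γ ∣ⱽ

  Supported : Edges n → Vec ℕ n → Set
  Supported E f = ∀ v → R ≤ toℕ v ⊎ ¬ v ∈ₛ E → lookup f v ≡ 0

  private
    weaken : ∀ {e : Fin n × Fin n} {E v} → R ≤ toℕ v ⊎ ¬ v ∈ₛ (e ∷ E) → R ≤ toℕ v ⊎ ¬ v ∈ₛ E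
    weaken (inj₁ R≤v) = inj₁ R≤v
    weaken (inj₂ v∉E) = inj₂ (v∉E ∘ there)

    transfer-supported : ∀ {i j E} → i ≢ j → toℕ i < R → ∀ f → Supported E f →
                         All (Supported ((i , j) ∷ E)) (transferExponents i j f)
    transfer-supported {i} {j} {E} i≢j i<R f sup = All.map (λ {g} → vanish {g}) (transferExponents-shape i≢j f)
      where
      vanish : ∀ {g} → lookup g j ≤ lookup f j × (∀ v → v ≢ i → v ≢ j → lookup g v ≡ lookup f v) →
               Supported ((i , j) ∷ E) g
      vanish {g} (gj≤fj , same) v cond with v Fin.≟ i | v Fin.≟ j
      ... | yes refl | _        = ⊥-elim ([ ℕ.<⇒≱ i<R , (λ i∉ → i∉ (here refl)) ]′ cond)
      ... | no  _    | yes refl = ℕ.n≤0⇒n≡0 (subst (lookup g v ≤_) (sup v (weaken {i , j} cond)) gj≤fj)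
      ... | no  v≢i  | no  v≢j  = trans (same v v≢i v≢j) (sup v (weaken {i , j} cond))

  newtonExponents-supported : ∀ E → Admissible E → All (Supported E) (newtonExponents E)
  newtonExponents-supported []            _              = (λ v _ → lookup-replicate v 0) ∷ []
  newtonExponents-supported ((i , j) ∷ E) (facts , adm) with toℕ j ℕ.<? S
  ... | no  _   = All.map (λ sup v → sup v ∘ weaken {i , j}) (newtonExponents-supported E adm)
  ... | yes j<S = All.concat⁺ (All.map⁺ (All.map (transfer-supported {E = E} (EdgeFacts.distinct facts) i<R _)
                                                  (newtonExponents-supported E adm)))
    where i<R = proj₂ (proj₂ (EdgeFacts.inner facts j<S))

  private
    sumV-zeros : ∀ m → sumV (replicate m 0) ≡ 0
    sumV-zeros zero    = refl
    sumV-zeros (suc m) = sumV-zeros m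

  newtonExponents-bounded : ∀ E → Admissible E → All (λ f → sumV f ≤ innerEdges E) (newtonExponents E)
  newtonExponents-bounded []            _             = ℕ.≤-reflexive (sumV-zeros n) ∷ []
  newtonExponents-bounded ((i , j) ∷ E) (facts , adm) with toℕ j ℕ.<? S
  ... | no  _ = newtonExponents-bounded E adm
  ... | yes _ = All.concat⁺ (All.map⁺ (All.map (λ {f} f≤ → All.map (λ g≤ → ℕ.≤-trans g≤ (s≤s f≤))
                                                           (transferExponents-bounded (EdgeFacts.distinct facts) f))
                                                (newtonExponents-bounded E adm)))

  newtonExponents-reaches : ∀ E → Admissible E → Any (λ f → sumV f ≡ innerEdges E) (newtonExponents E)
  newtonExponents-reaches []            _             = here (sumV-zeros n)
  newtonExponents-reaches ((i , j) ∷ E) (facts , adm) with toℕ j ℕ.<? S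
  ... | no  _ = newtonExponents-reaches E adm
  ... | yes _ = Any.concat⁺ (Any.map⁺ (Any.map (λ {f} f≡ → Any.map (λ g≡ → trans g≡ (cong suc f≡))
                                                           (transferExponents-reaches (EdgeFacts.distinct facts) f))
                                                (newtonExponents-reaches E adm)))

  flowCount-[] : CountedBy [] (newtonExponents [])
  flowCount-[] γ inv with ≡-dec ℤ._≟_ (tabulate (λ _ → + 0)) γ
  ... | yes _   = sym (trans (ℕ.+-identityʳ _) (∏-zero (λ v → ∣ γ ∣ⱽ v C lookup (replicate n 0) v)
                                                       (λ v → cong (∣ γ ∣ⱽ v C_) (lookup-replicate v 0))))
  ... | no  γ≢0 = ⊥-elim (γ≢0 (tabulate-≡⁺ (λ v → sym (γ≡0 v))))
    where
    open Invariant inv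
    off-sink : ∀ v → v ≢ sink → lookup γ v ≡ + 0
    off-sink v v≢sink = idle v (≢sink⇒<n′ v≢sink) (λ ())
    γ≡0 : ∀ v → lookup γ v ≡ + 0
    γ≡0 v with v Fin.≟ sink
    ... | yes refl   = trans (sym (ℤΣ.sum-single (lookup γ) sink off-sink)) balanced
    ... | no  v≢sink = off-sink v v≢sink

  private
    ∣+m-+n∣ : ∀ m k → k ≤ m → ∣ + m - + k ∣ ≡ m ∸ k
    ∣+m-+n∣ m k k≤m = cong ∣_∣ (trans (ℤ.[+m]-[+n]≡m⊖n m k) (ℤ.⊖-≥ k≤m))

    +≡+∣∣ : ∀ {g} → + 0 ℤ.≤ g → g ≡ + ∣ g ∣
    +≡+∣∣ 0≤g = sym (ℤ.0≤i⇒+∣i∣≡i 0≤g)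

  module _ {i j : Fin n} {E : Edges n} (facts : EdgeFacts i j E) where
    open EdgeFacts facts

    flowCount-inner-edge : toℕ j < S → ∀ L → CountedBy E L → CountedBy ((i , j) ∷ E) (concatMap (transferExponents i j) L)
    flowCount-inner-edge j<S L IH γ inv = begin
      ∑[ x < choices (lookup γ i) ] flowCount E (γ′ (toℕ x))
        ≡⟨ cong (λ g → ∑[ x < choices g ] flowCount E (γ′ (toℕ x))) γi≡zi ⟩
      ∑[ x < suc zi ] flowCount E (γ′ (toℕ x))
        ≡⟨ sum-cong-≗ {suc zi} (λ x → IH (γ′ (toℕ x)) (invariant (toℕ x) (x≤zi x))) ⟩
      ∑[ x < suc zi ] newtonSum L ∣ γ′ (toℕ x) ∣ⱽ
        ≡⟨ sum-cong-≗ {suc zi} (λ x → newtonSum-cong-≗ L (∣residual∣ (toℕ x) (x≤zi x))) ⟩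
      ∑[ x < suc zi ] newtonSum L (transfer i j (toℕ x) ∣ γ ∣ⱽ)
        ≡⟨ newtonSum-transfer distinct L ∣ γ ∣ⱽ ⟩
      newtonSum (concatMap (transferExponents i j) L) ∣ γ ∣ⱽ
        ∎
      where
      open ≡-Reasoning
      open Invariant inv
      i∈E = proj₁ (inner j<S)
      j∈E = proj₁ (proj₂ (inner j<S))
      i<n′ = ℕ.<-≤-trans (proj₂ (proj₂ (inner j<S))) (ℕ.≤-trans R≤S S≤n′)
      j<n′ = ℕ.<-≤-trans j<S S≤n′
      zi = ∣ γ ∣ⱽ i
      γi≡zi : lookup γ i ≡ + zi
      γi≡zi = +≡+∣∣ (nonneg i i<n′)
      γj≡zj : lookup γ j ≡ + ∣ γ ∣ⱽ j
      γj≡zj = +≡+∣∣ (nonneg j j<n′)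
      x≤zi : (x : Fin (suc zi)) → toℕ x ≤ zi
      x≤zi x = ℕ.≤-pred (Fin.toℕ<n x)
      γ′ : ℕ → Vec ℤ n
      γ′ x = residual γ i j x
      invariant : ∀ x → x ≤ zi → Invariant E (γ′ x)
      invariant x x≤zi = record
        { nonneg   = nonneg′
        ; idle     = λ v v<n′ v∉E → trans (residual-other γ x v (∉ₛ⇒≢ i∈E v∉E) (∉ₛ⇒≢ j∈E v∉E))
                                          (idle v v<n′ (∉ₛ-∷ (∉ₛ⇒≢ i∈E v∉E) v∉E))
        ; balanced = trans (sum-residual γ x distinct) balanced
        }
        where
        nonneg′ : ∀ v → toℕ v < n′ → + 0 ℤ.≤ lookup (γ′ x) v
        nonneg′ v v<n′ with v Fin.≟ i | v Fin.≟ j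
        ... | yes refl | _        = subst (+ 0 ℤ.≤_) (sym (trans (residual-source γ x distinct) (cong (ℤ._- + x) γi≡zi)))
                                           (ℤ.i≤j⇒0≤j-i (+≤+ x≤zi))
        ... | no  _    | yes refl = subst (+ 0 ℤ.≤_) (sym (residual-target γ x distinct)) (ℤ.+-mono-≤ (nonneg j j<n′) (+≤+ z≤n))
        ... | no  v≢i  | no  v≢j  = subst (+ 0 ℤ.≤_) (sym (residual-other γ x v v≢i v≢j)) (nonneg v v<n′)
      ∣residual∣ : ∀ x → x ≤ zi → ∀ v → ∣ γ′ x ∣ⱽ v ≡ transfer i j x ∣ γ ∣ⱽ v
      ∣residual∣ x x≤zi v with v Fin.≟ i | v Fin.≟ j
      ... | yes refl | _        = trans (cong ∣_∣ (trans (residual-source γ x distinct) (cong (ℤ._- + x) γi≡zi)))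
                                        (trans (∣+m-+n∣ zi x x≤zi) (sym (transfer-source distinct x ∣ γ ∣ⱽ)))
      ... | no  _    | yes refl = trans (cong ∣_∣ (trans (residual-target γ x distinct) (cong (ℤ._+ + x) γj≡zj)))
                                        (sym (transfer-target distinct x ∣ γ ∣ⱽ))
      ... | no  v≢i  | no  v≢j  = trans (cong ∣_∣ (residual-other γ x v v≢i v≢j))
                                        (sym (transfer-other distinct x ∣ γ ∣ⱽ v v≢i v≢j))

    flowCount-dead-end-edge : SourcesFirst E → S ≤ toℕ j → toℕ j < n′ → ∀ L → CountedBy E L → CountedBy ((i , j) ∷ E) L
    flowCount-dead-end-edge sf S≤j j<n′ L IH γ inv = begin
      ∑[ x < choices (lookup γ i) ] F (toℕ x)
        ≡⟨ cong (λ g → ∑[ x < choices g ] F (toℕ x)) (+≡+∣∣ (nonneg i i<n′)) ⟩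
      ∑[ x < suc (∣ γ ∣ⱽ i) ] F (toℕ x)
        ≡⟨ sum-single {suc (∣ γ ∣ⱽ i)} (F ∘ toℕ) Fin.zero
                      (λ { Fin.zero 0≢0 → ⊥-elim (0≢0 refl) ; (Fin.suc x) _ → no-flow (toℕ x) }) ⟩
      flowCount E (residual γ i j 0)
        ≡⟨ cong (flowCount E) (residual-zero γ i j) ⟩
      flowCount E γ
        ≡⟨ IH γ invariant ⟩
      newtonSum L ∣ γ ∣ⱽ
        ∎
      where
      open ≡-Reasoning
      open Invariant inv
      i∈E = proj₁ (dead-end S≤j j<n′)
      j∉E = proj₂ (dead-end S≤j j<n′)
      i<n′ = ℕ.<-trans forward j<n′
      F : ℕ → ℕ
      F x = flowCount E (residual γ i j x)
      γj≡0 : lookup γ j ≡ + 0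
      γj≡0 = idle j j<n′ (∉ₛ-∷ (distinct ∘ sym) j∉E)
      no-flow : ∀ x → F (suc x) ≡ 0
      no-flow x = ¬Flows⇒flowCount≡0 E sf (residual γ i j (suc x)) λ (m , q) →
        let net≡ = trans (tabulate-≡⁻ (netAt (zip E (toList m))) q j)
                         (trans (residual-target γ (suc x) distinct) (cong (ℤ._+ + suc x) γj≡0)) in
        positive (subst (ℤ._≤ + 0) net≡ (netAt-nonpos j E (toList m) j∉E))
        where
        positive : ¬ (+ suc x ℤ.≤ + 0)
        positive (+≤+ ())
      invariant : Invariant E γ
      invariant = record
        { nonneg   = nonneg
        ; idle     = λ v v<n′ v∉E → idle v v<n′ (∉ₛ-∷ (∉ₛ⇒≢ i∈E v∉E) v∉E)
        ; balanced = balanced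
        }

    flowCount-sink-edge : SourcesFirst E → j ≡ sink → ∀ L → All (Supported E) L → CountedBy E L → CountedBy ((i , j) ∷ E) L
    flowCount-sink-edge sf j≡sink L supported IH γ inv = begin
      ∑[ x < choices (lookup γ i) ] F (toℕ x)
        ≡⟨ cong (λ g → ∑[ x < choices g ] F (toℕ x)) γi≡zi ⟩
      ∑[ x < suc zi ] F (toℕ x)
        ≡⟨ sum-single {suc zi} (F ∘ toℕ) (fromℕ zi) (λ x x≢zi → no-flow (toℕ x) (x≢zi ∘ toℕ≡zi)) ⟩
      F (toℕ (fromℕ zi))
        ≡⟨ cong F (Fin.toℕ-fromℕ zi) ⟩
      flowCount E γ′
        ≡⟨ IH γ′ invariant ⟩
      newtonSum L ∣ γ′ ∣ⱽ
        ≡⟨ newtonSum-cong L (All.map (λ {f} sup v → agree {f} sup v) supported) ⟩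
      newtonSum L ∣ γ ∣ⱽ
        ∎
      where
      open ≡-Reasoning
      open Invariant inv
      i∉E = into-sink j≡sink
      i<n′ = ℕ.<-≤-trans forward (ℕ.≤-reflexive (trans (cong toℕ j≡sink) (Fin.toℕ-fromℕ n′)))
      zi = ∣ γ ∣ⱽ i
      γi≡zi : lookup γ i ≡ + zi
      γi≡zi = +≡+∣∣ (nonneg i i<n′)
      F : ℕ → ℕ
      F x = flowCount E (residual γ i j x)
      γ′ = residual γ i j zi
      γ′i≡0 : lookup γ′ i ≡ + 0
      γ′i≡0 = trans (residual-source γ zi distinct) (trans (cong (ℤ._- + zi) γi≡zi) (ℤ.+-inverseʳ (+ zi)))
      toℕ≡zi : ∀ {x : Fin (suc zi)} → toℕ x ≡ zi → x ≡ fromℕ zi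
      toℕ≡zi eq = Fin.toℕ-injective (trans eq (sym (Fin.toℕ-fromℕ zi)))
      no-flow : ∀ x → x ≢ zi → F x ≡ 0
      no-flow x x≢zi = ¬Flows⇒flowCount≡0 E sf (residual γ i j x) λ (m , q) →
        x≢zi (sym (ℤ.+-injective (ℤ.i-j≡0⇒i≡j (+ zi) (+ x)
          (trans (sym (trans (tabulate-≡⁻ (netAt (zip E (toList m))) q i) (trans (residual-source γ x distinct) (cong (ℤ._- + x) γi≡zi))))
                 (netAt-zero i E (toList m) i∉E source-fresh)))))
      v≢j : ∀ v → toℕ v < n′ → v ≢ j
      v≢j v v<n′ v≡j = <n′⇒≢sink v<n′ (trans v≡j j≡sink)
      invariant : Invariant E γ′
      invariant = record
        { nonneg   = λ v v<n′ → case-i v (λ { refl → subst (+ 0 ℤ.≤_) (sym γ′i≡0) (+≤+ z≤n) })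
                                        (λ v≢i → subst (+ 0 ℤ.≤_) (sym (residual-other γ zi v v≢i (v≢j v v<n′))) (nonneg v v<n′))
        ; idle     = λ v v<n′ v∉E → case-i v (λ { refl → γ′i≡0 })
                                            (λ v≢i → trans (residual-other γ zi v v≢i (v≢j v v<n′))
                                                           (idle v v<n′ (∉ₛ-∷ v≢i v∉E)))
        ; balanced = trans (sum-residual γ zi distinct) balanced
        }
        where
        case-i : ∀ {P : Set} v → (v ≡ i → P) → (v ≢ i → P) → P
        case-i v yes′ no′ with v Fin.≟ i
        ... | yes v≡i = yes′ v≡i
        ... | no  v≢i = no′ v≢i
      agree : ∀ {f} → Supported E f → ∀ v → lookup f v ≡ 0 ⊎ ∣ γ′ ∣ⱽ v ≡ ∣ γ ∣ⱽ v
      agree {f} sup v with v Fin.≟ i | v Fin.≟ j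
      ... | yes refl | _        = inj₁ (sup v (inj₂ i∉E))
      ... | no  _    | yes refl = inj₁ (sup v (inj₁ (subst (R ≤_) (sym (trans (cong toℕ j≡sink) (Fin.toℕ-fromℕ n′)))
                                                           (ℕ.≤-trans R≤S S≤n′))))
      ... | no  v≢i  | no  v≢j  = inj₂ (cong ∣_∣ (residual-other γ zi v v≢i v≢j))

  flowCount≡newtonSum : ∀ E → Admissible E → CountedBy E (newtonExponents E)
  flowCount≡newtonSum []            _             = flowCount-[]
  flowCount≡newtonSum ((i , j) ∷ E) (facts , adm) with toℕ j ℕ.<? S | below-or-sink j
  ... | yes j<S | _           = flowCount-inner-edge facts j<S (newtonExponents E) (flowCount≡newtonSum E adm)
  ... | no  j≮S | inj₁ j<n′   = flowCount-dead-end-edge facts (Admissible⇒SourcesFirst E adm) (ℕ.≮⇒≥ j≮S) j<n′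
                                                        (newtonExponents E) (flowCount≡newtonSum E adm)
  ... | no  _   | inj₂ j≡sink = flowCount-sink-edge facts (Admissible⇒SourcesFirst E adm) j≡sink (newtonExponents E)
                                                    (newtonExponents-supported E adm) (flowCount≡newtonSum E adm)

module BinomialPolynomial where

  open import Data.Nat.Base as ℕ using (ℕ; zero; suc; _≤_; _<_; s≤s)
  import Data.Nat.Properties as ℕ
  open import Data.Nat.Combinatorics using (_C_)
  open import Data.Integer.Base as ℤ using (ℤ; +_)
  import Data.Integer.Properties as ℤ
  import Data.Integer.Solver as ℤ-Solver
  open import Data.Rational.Base as ℚ using (ℚ; _+_; _*_; -_; 0ℚ; 1ℚ; _/_; toℚᵘ)
  import Data.Rational.Properties as ℚ
  open import Data.Rational.Unnormalised.Base as ℚᵘ using (mkℚᵘ; *≡*)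
  import Data.Rational.Unnormalised.Properties as ℚᵘ
  open import Data.Rational.Solver using (module +-*-Solver)
  open import Data.Fin.Base using (Fin; zero; suc; toℕ)
  open import Relation.Binary.PropositionalEquality
  open import Defs using (powℚ)
  open BinomialIdentities using (C-absorption)
  open import Algebra.Bundles using (CommutativeRing)
  open FinSum ℚ.+-0-commutativeMonoid using (sum; sum-syntax; sum-cong-≗; ∑-distrib-+; sum-zero)
  open import Algebra.Properties.Semiring.Sum (CommutativeRing.semiring ℚ.+-*-commutativeRing) using (*-distribˡ-sum)

  toℚ : ℕ → ℚ
  toℚ n = + n / 1

  private
    toℚᵘ-toℚ : ∀ n → toℚᵘ (toℚ n) ℚᵘ.≃ mkℚᵘ (+ n) 0
    toℚᵘ-toℚ n = ℚ.toℚᵘ-fromℚᵘ (mkℚᵘ (+ n) 0)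

  toℚ-+ : ∀ m n → toℚ (m ℕ.+ n) ≡ toℚ m + toℚ n
  toℚ-+ m n = ℚ.toℚᵘ-injective (ℚᵘ.≃-trans (toℚᵘ-toℚ (m ℕ.+ n)) (ℚᵘ.≃-trans (*≡* eq)
    (ℚᵘ.≃-sym (ℚᵘ.≃-trans (ℚ.toℚᵘ-homo-+ (toℚ m) (toℚ n)) (ℚᵘ.+-cong (toℚᵘ-toℚ m) (toℚᵘ-toℚ n))))))
    where
    open ℤ-Solver.+-*-Solver
    eq : + (m ℕ.+ n) ℤ.* + 1 ≡ (+ m ℤ.* + 1 ℤ.+ + n ℤ.* + 1) ℤ.* + 1
    eq = trans (cong (ℤ._* + 1) (ℤ.pos-+ m n))
               (solve 2 (λ a b → (a :+ b) :* con (+ 1) := (a :* con (+ 1) :+ b :* con (+ 1)) :* con (+ 1)) refl (+ m) (+ n))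

  toℚ-* : ∀ m n → toℚ (m ℕ.* n) ≡ toℚ m * toℚ n
  toℚ-* m n = ℚ.toℚᵘ-injective (ℚᵘ.≃-trans (toℚᵘ-toℚ (m ℕ.* n)) (ℚᵘ.≃-trans (*≡* eq)
    (ℚᵘ.≃-sym (ℚᵘ.≃-trans (ℚ.toℚᵘ-homo-* (toℚ m) (toℚ n)) (ℚᵘ.*-cong (toℚᵘ-toℚ m) (toℚᵘ-toℚ n))))))
    where
    eq : + (m ℕ.* n) ℤ.* + 1 ≡ (+ m ℤ.* + n) ℤ.* + 1
    eq = cong (ℤ._* + 1) (ℤ.pos-* m n)

  1/suc : ℕ → ℚ
  1/suc k = + 1 / suc k

  toℚ-suc*1/suc : ∀ k → toℚ (suc k) * 1/suc k ≡ 1ℚ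
  toℚ-suc*1/suc k = ℚ.toℚᵘ-injective (ℚᵘ.≃-trans (ℚ.toℚᵘ-homo-* (toℚ (suc k)) (1/suc k))
    (ℚᵘ.≃-trans (ℚᵘ.*-cong (toℚᵘ-toℚ (suc k)) (ℚ.toℚᵘ-fromℚᵘ (mkℚᵘ (+ 1) k))) (*≡* eq)))
    where
    eq : (+ suc k ℤ.* + 1) ℤ.* + 1 ≡ + 1 ℤ.* + (1 ℕ.* suc k)
    eq = cong +_ (trans (ℕ.*-identityʳ _) (trans (ℕ.*-identityʳ _) (sym (trans (ℕ.*-identityˡ _) (ℕ.*-identityˡ _)))))

  -- The recursion is C(X, k+1) = C(X, k) · (X − k) / (k+1), read off coefficientwise.
  binomialCoeff : ℕ → ℕ → ℚ
  binomialCoeff zero    zero    = 1ℚ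
  binomialCoeff zero    (suc j) = 0ℚ
  binomialCoeff (suc k) zero    = (- (toℚ k * binomialCoeff k 0)) * 1/suc k
  binomialCoeff (suc k) (suc j) = (binomialCoeff k j + - (toℚ k * binomialCoeff k (suc j))) * 1/suc k

  binomialCoeff-vanish : ∀ k j → k < j → binomialCoeff k j ≡ 0ℚ
  binomialCoeff-vanish zero    (suc j) _         = refl
  binomialCoeff-vanish (suc k) (suc j) (s≤s k<j) = begin
    (binomialCoeff k j + - (toℚ k * binomialCoeff k (suc j))) * 1/suc k
      ≡⟨ cong₂ (λ a b → (a + - (toℚ k * b)) * 1/suc k) (binomialCoeff-vanish k j k<j)
                                                         (binomialCoeff-vanish k (suc j) (ℕ.m<n⇒m<1+n k<j)) ⟩
    (0ℚ + - (toℚ k * 0ℚ)) * 1/suc k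
      ≡⟨ cong (λ t → (0ℚ + - t) * 1/suc k) (ℚ.*-zeroʳ (toℚ k)) ⟩
    (0ℚ + - 0ℚ) * 1/suc k
      ≡⟨ ℚ.*-zeroˡ (1/suc k) ⟩
    0ℚ
      ∎
    where open ≡-Reasoning

  *-≢0 : ∀ {a b} → a ≢ 0ℚ → b ≢ 0ℚ → a * b ≢ 0ℚ
  *-≢0 {a} {b} a≢0 b≢0 ab≡0 = a≢0 (begin
    a                  ≡⟨ ℚ.*-identityʳ a ⟨
    a * 1ℚ             ≡⟨ cong (a *_) (ℚ.*-inverseʳ b) ⟨
    a * (b * 1/b)      ≡⟨ ℚ.*-assoc a b 1/b ⟨
    (a * b) * 1/b      ≡⟨ cong (_* 1/b) ab≡0 ⟩
    0ℚ * 1/b           ≡⟨ ℚ.*-zeroˡ 1/b ⟩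
    0ℚ                 ∎)
    where
    open ≡-Reasoning
    instance _ = ℚ.≢-nonZero b≢0
    1/b = ℚ.1/ b

  1/suc≢0 : ∀ k → 1/suc k ≢ 0ℚ
  1/suc≢0 k ρ≡0 = ℚ.1≢0 (trans (sym (toℚ-suc*1/suc k)) (trans (cong (toℚ (suc k) *_) ρ≡0) (ℚ.*-zeroʳ (toℚ (suc k)))))

  toℚ-suc≢0 : ∀ k → toℚ (suc k) ≢ 0ℚ
  toℚ-suc≢0 k s≡0 = ℚ.1≢0 (trans (sym (toℚ-suc*1/suc k)) (trans (cong (_* 1/suc k) s≡0) (ℚ.*-zeroˡ (1/suc k))))

  binomialCoeff-leading : ∀ k → binomialCoeff k k ≢ 0ℚ
  binomialCoeff-leading zero    ()
  binomialCoeff-leading (suc k) = subst (_≢ 0ℚ) (sym diagonal) (*-≢0 (binomialCoeff-leading k) (1/suc≢0 k))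
    where
    diagonal : binomialCoeff (suc k) (suc k) ≡ binomialCoeff k k * 1/suc k
    diagonal = begin
      (binomialCoeff k k + - (toℚ k * binomialCoeff k (suc k))) * 1/suc k
        ≡⟨ cong (λ c → (binomialCoeff k k + - (toℚ k * c)) * 1/suc k) (binomialCoeff-vanish k (suc k) (ℕ.n<1+n k)) ⟩
      (binomialCoeff k k + - (toℚ k * 0ℚ)) * 1/suc k
        ≡⟨ cong (λ t → (binomialCoeff k k + - t) * 1/suc k) (ℚ.*-zeroʳ (toℚ k)) ⟩
      (binomialCoeff k k + - 0ℚ) * 1/suc k
        ≡⟨ cong (_* 1/suc k) (ℚ.+-identityʳ (binomialCoeff k k)) ⟩
      binomialCoeff k k * 1/suc k
        ∎
      where open ≡-Reasoning

  binomialPoly : ℕ → ℕ → ℚ → ℚ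
  binomialPoly k K X = ∑[ j < suc K ] (binomialCoeff k (toℕ j) * powℚ X (toℕ j))

  binomialPoly-step : ∀ k K X →
    binomialPoly (suc k) (suc K) X ≡ (X * binomialPoly k K X + - (toℚ k * binomialPoly k (suc K) X)) * 1/suc k
  binomialPoly-step k K X = begin
    c′₀ * 1ℚ + ∑[ j < suc K ] ((c (toℕ j) + - (κ * c (suc (toℕ j)))) * ρ * (X * powℚ X (toℕ j)))
      ≡⟨ cong (_+_ (c′₀ * 1ℚ)) (sum-cong-≗ {suc K} λ j →
           solve 6 (λ a b κ ρ X p → (a :+ :- (κ :* b)) :* ρ :* (X :* p) := (ρ :* X) :* (a :* p) :+ (:- (ρ :* κ)) :* (b :* (X :* p)))
                 refl (c (toℕ j)) (c (suc (toℕ j))) κ ρ X (powℚ X (toℕ j))) ⟩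
    c′₀ * 1ℚ + ∑[ j < suc K ] ((ρ * X) * s₁ j + (- (ρ * κ)) * s₂ j)
      ≡⟨ cong (_+_ (c′₀ * 1ℚ)) (trans (∑-distrib-+ (λ j → (ρ * X) * s₁ j) (λ j → (- (ρ * κ)) * s₂ j))
                                   (cong₂ _+_ (sym (*-distribˡ-sum (ρ * X) s₁)) (sym (*-distribˡ-sum (- (ρ * κ)) s₂)))) ⟩
    c′₀ * 1ℚ + ((ρ * X) * ∑[ j < suc K ] s₁ j + (- (ρ * κ)) * ∑[ j < suc K ] s₂ j)
      ≡⟨ solve 6 (λ κ c₀ ρ X S₁ S₂ → (:- (κ :* c₀)) :* ρ :* con 1ℚ :+ ((ρ :* X) :* S₁ :+ (:- (ρ :* κ)) :* S₂)
                                     := (X :* S₁ :+ :- (κ :* (c₀ :* con 1ℚ :+ S₂))) :* ρ)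
               refl κ (c 0) ρ X (∑[ j < suc K ] s₁ j) (∑[ j < suc K ] s₂ j) ⟩
    (X * binomialPoly k K X + - (κ * binomialPoly k (suc K) X)) * ρ
      ∎
    where
    open ≡-Reasoning
    open Data.Rational.Solver.+-*-Solver
    c : ℕ → ℚ
    c = binomialCoeff k
    κ = toℚ k
    ρ = 1/suc k
    c′₀ = binomialCoeff (suc k) 0
    s₁ s₂ : Fin (suc K) → ℚ
    s₁ j = c (toℕ j) * powℚ X (toℕ j)
    s₂ j = c (suc (toℕ j)) * (X * powℚ X (toℕ j))

  binomialPoly-toℚ : ∀ x k K → k ≤ K → binomialPoly k K (toℚ x) ≡ toℚ (x C k)
  binomialPoly-toℚ x zero    K       _         =
    trans (cong (_+_ (1ℚ * 1ℚ)) (sum-zero {K} _ (λ j → ℚ.*-zeroˡ (powℚ (toℚ x) (suc (toℕ j)))))) refl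
  binomialPoly-toℚ x (suc k) (suc K) (s≤s k≤K) = begin
    binomialPoly (suc k) (suc K) X
      ≡⟨ binomialPoly-step k K X ⟩
    (X * binomialPoly k K X + - (κ * binomialPoly k (suc K) X)) * ρ
      ≡⟨ cong₂ (λ u w → (X * u + - (κ * w)) * ρ) (binomialPoly-toℚ x k K k≤K)
                                                  (binomialPoly-toℚ x k (suc K) (ℕ.m≤n⇒m≤1+n k≤K)) ⟩
    (X * B + - (κ * B)) * ρ
      ≡⟨ cong (λ t → (t + - (κ * B)) * ρ) absorption ⟩
    (toℚ (suc k) * B′ + κ * B + - (κ * B)) * ρ
      ≡⟨ solve 4 (λ s B′ κB ρ → (s :* B′ :+ κB :+ :- κB) :* ρ := (s :* ρ) :* B′) refl (toℚ (suc k)) B′ (κ * B) ρ ⟩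
    (toℚ (suc k) * ρ) * B′
      ≡⟨ trans (cong (_* B′) (toℚ-suc*1/suc k)) (ℚ.*-identityˡ B′) ⟩
    B′
      ∎
    where
    open ≡-Reasoning
    open Data.Rational.Solver.+-*-Solver
    X = toℚ x
    κ = toℚ k
    ρ = 1/suc k
    B = toℚ (x C k)
    B′ = toℚ (x C suc k)
    absorption : X * B ≡ toℚ (suc k) * B′ + κ * B
    absorption = begin
      X * B                                  ≡⟨ toℚ-* x (x C k) ⟨
      toℚ (x ℕ.* (x C k))                    ≡⟨ cong toℚ (C-absorption x k) ⟨
      toℚ (suc k ℕ.* (x C suc k) ℕ.+ k ℕ.* (x C k)) ≡⟨ toℚ-+ (suc k ℕ.* (x C suc k)) (k ℕ.* (x C k)) ⟩
      toℚ (suc k ℕ.* (x C suc k)) + toℚ (k ℕ.* (x C k)) ≡⟨ cong₂ _+_ (toℚ-* (suc k) (x C suc k)) (toℚ-* k (x C k)) ⟩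
      toℚ (suc k) * B′ + κ * B               ∎

module MonomialExpansion where

  open import Data.Nat.Base as ℕ using (ℕ; zero; suc; _∸_; _≤_; _<_)
  import Data.Nat.Properties as ℕ
  open import Data.Nat.Combinatorics using (_C_)
  open import Data.Rational.Base as ℚ using (ℚ; _+_; _*_; 0ℚ; 1ℚ)
  import Data.Rational.Properties as ℚ
  open import Data.Rational.Solver using (module +-*-Solver)
  open import Data.Fin.Base using (Fin; zero; suc; toℕ)
  open import Data.Vec.Base as Vec using (Vec; []; _∷_; lookup; tabulate)
  import Data.Vec.Properties as Vec
  open import Data.List.Base using (List; []; _∷_; map; upTo)
  open import Data.List.Relation.Unary.All as All using (All; []; _∷_)
  open import Data.List.Relation.Unary.Any using (Any; here; there)
  open import Data.Product.Base using (∃; _,_; proj₁; proj₂)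
  open import Data.List.Membership.Propositional using (_∈_; find)
  open import Data.Empty using (⊥-elim)
  open import Relation.Nullary using (yes; no)
  open import Function.Base using (_∘_)
  open import Relation.Binary.PropositionalEquality
  open import Algebra.Bundles using (CommutativeRing)
  open import Defs using (powℚ; monomial; eval; exps; sumV; HasDegree)
  open NewtonBasis using (newton; newtonSum)
  open FinSum ℕ.*-1-commutativeMonoid using () renaming (sum to ∏)
  open BinomialPolynomial
  open FinSum ℚ.+-0-commutativeMonoid using (sum; sum-syntax; sum-cong-≗)
  open import Algebra.Properties.Semiring.Sum (CommutativeRing.semiring ℚ.+-*-commutativeRing) using (*-distribʳ-sum)
  open ListSum (CommutativeRing.commutativeSemiring ℚ.+-*-commutativeRing)
  open +-*-Solver

  ∏ⱽ : ∀ {m} → (Fin m → ℚ) → ℚ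
  ∏ⱽ g = Vec.foldr _ _*_ 1ℚ (tabulate g)

  ∏ⱽ-zero : ∀ {m} (g : Fin m → ℚ) a → g a ≡ 0ℚ → ∏ⱽ g ≡ 0ℚ
  ∏ⱽ-zero g zero    ga≡0 = trans (cong (_* ∏ⱽ (g ∘ suc)) ga≡0) (ℚ.*-zeroˡ (∏ⱽ (g ∘ suc)))
  ∏ⱽ-zero g (suc a) ga≡0 = trans (cong (g zero *_) (∏ⱽ-zero (λ a → g (suc a)) a ga≡0)) (ℚ.*-zeroʳ (g zero))

  ∏ⱽ-≢0 : ∀ {m} (g : Fin m → ℚ) → (∀ a → g a ≢ 0ℚ) → ∏ⱽ g ≢ 0ℚ
  ∏ⱽ-≢0 {zero}  g g≢0 ()
  ∏ⱽ-≢0 {suc m} g g≢0 = *-≢0 (g≢0 zero) (∏ⱽ-≢0 (λ a → g (suc a)) (λ a → g≢0 (suc a)))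

  ∏ⱽ-toℚ : ∀ {m} (h : Fin m → ℕ) → ∏ⱽ (toℚ ∘ h) ≡ toℚ (∏ h)
  ∏ⱽ-toℚ {zero}  h = refl
  ∏ⱽ-toℚ {suc m} h = trans (cong (toℚ (h zero) *_) (∏ⱽ-toℚ (h ∘ suc))) (sym (toℚ-* (h zero) (∏ (h ∘ suc))))

  newtonCoeff : ∀ {m} → Vec ℕ m → Vec ℕ m → ℚ
  newtonCoeff f e = ∏ⱽ (λ a → binomialCoeff (lookup f a) (lookup e a))

  newton-expansion : ∀ m D (f : Vec ℕ m) → sumV f ≤ D → (z : Fin m → ℕ) →
    ∑ₗ (exps m D) (λ e → newtonCoeff f e * monomial e (toℚ ∘ z)) ≡ toℚ (newton f z)
  newton-expansion zero    D []       _   z = trans (ℚ.+-identityʳ _) (ℚ.*-identityˡ 1ℚ)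
  newton-expansion (suc m) D (f₀ ∷ f) f≤D z = begin
    ∑ₗ (exps (suc m) D) G
      ≡⟨ ∑ₗ-concatMap (λ e₀ → map (e₀ ∷_) (exps m (D ∸ e₀))) (upTo (suc D)) G ⟩
    ∑ₗ (upTo (suc D)) (λ e₀ → ∑ₗ (map (e₀ ∷_) (exps m (D ∸ e₀))) G)
      ≡⟨ ∑ₗ-applyUpTo (λ e₀ → e₀) (suc D) (λ e₀ → ∑ₗ (map (e₀ ∷_) (exps m (D ∸ e₀))) G) ⟩
    ∑[ e₀ < suc D ] ∑ₗ (map (toℕ e₀ ∷_) (exps m (D ∸ toℕ e₀))) G
      ≡⟨ sum-cong-≗ {suc D} (λ e₀ → first-variable (toℕ e₀)) ⟩
    ∑[ e₀ < suc D ] ((binomialCoeff f₀ (toℕ e₀) * powℚ x₀ (toℕ e₀)) * Q)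
      ≡⟨ *-distribʳ-sum {suc D} Q (λ e₀ → binomialCoeff f₀ (toℕ e₀) * powℚ x₀ (toℕ e₀)) ⟨
    binomialPoly f₀ D x₀ * Q
      ≡⟨ cong (_* Q) (binomialPoly-toℚ (z zero) f₀ D (ℕ.≤-trans (ℕ.m≤m+n f₀ (sumV f)) f≤D)) ⟩
    toℚ (z zero C f₀) * Q
      ≡⟨ toℚ-* (z zero C f₀) _ ⟨
    toℚ (newton (f₀ ∷ f) z)
      ∎
    where
    open ≡-Reasoning
    x₀ = toℚ (z zero)
    G : Vec ℕ (suc m) → ℚ
    G e = newtonCoeff (f₀ ∷ f) e * monomial e (toℚ ∘ z)
    Q = toℚ (newton f (z ∘ suc))
    first-variable : ∀ e₀ → ∑ₗ (map (e₀ ∷_) (exps m (D ∸ e₀))) G ≡ (binomialCoeff f₀ e₀ * powℚ x₀ e₀) * Q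
    first-variable e₀ = begin
      ∑ₗ (map (e₀ ∷_) (exps m (D ∸ e₀))) G
        ≡⟨ ∑ₗ-map (e₀ ∷_) (exps m (D ∸ e₀)) G ⟩
      ∑ₗ (exps m (D ∸ e₀)) (λ e → (c₀ * newtonCoeff f e) * (powℚ x₀ e₀ * monomial e (toℚ ∘ z ∘ suc)))
        ≡⟨ ∑ₗ-cong (exps m (D ∸ e₀)) (All.universal (λ e → solve 4 (λ a b c d → (a :* b) :* (c :* d) := (a :* c) :* (b :* d)) refl
                                                        c₀ (newtonCoeff f e) (powℚ x₀ e₀) (monomial e (toℚ ∘ z ∘ suc))) _) ⟩
      ∑ₗ (exps m (D ∸ e₀)) (λ e → (c₀ * powℚ x₀ e₀) * (newtonCoeff f e * monomial e (toℚ ∘ z ∘ suc)))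
        ≡⟨ *-distribˡ-∑ₗ (exps m (D ∸ e₀)) _ (c₀ * powℚ x₀ e₀) ⟨
      (c₀ * powℚ x₀ e₀) * ∑ₗ (exps m (D ∸ e₀)) (λ e → newtonCoeff f e * monomial e (toℚ ∘ z ∘ suc))
        ≡⟨ rest-variables ⟩
      (c₀ * powℚ x₀ e₀) * Q
        ∎
      where
      c₀ = binomialCoeff f₀ e₀
      rest-variables : (c₀ * powℚ x₀ e₀) * ∑ₗ (exps m (D ∸ e₀)) (λ e → newtonCoeff f e * monomial e (toℚ ∘ z ∘ suc))
                     ≡ (c₀ * powℚ x₀ e₀) * Q
      rest-variables with e₀ ℕ.≤? f₀
      ... | yes e₀≤f₀ = cong ((c₀ * powℚ x₀ e₀) *_) (newton-expansion m (D ∸ e₀) f f≤D∸e₀ (z ∘ suc))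
        where f≤D∸e₀ = ℕ.≤-trans (ℕ.m+n≤o⇒m≤o∸n (sumV f) (subst (_≤ D) (ℕ.+-comm f₀ (sumV f)) f≤D))
                                 (ℕ.∸-monoʳ-≤ D e₀≤f₀)
      ... | no  e₀≰f₀ rewrite binomialCoeff-vanish f₀ e₀ (ℕ.≰⇒> e₀≰f₀) = trans (vanishes S) (sym (vanishes Q))
        where
        S = ∑ₗ (exps m (D ∸ e₀)) (λ e → newtonCoeff f e * monomial e (toℚ ∘ z ∘ suc))
        vanishes : ∀ t → (0ℚ * powℚ x₀ e₀) * t ≡ 0ℚ
        vanishes t = trans (cong (_* t) (ℚ.*-zeroˡ (powℚ x₀ e₀))) (ℚ.*-zeroˡ t)

  newtonPolynomial : ∀ {m} → List (Vec ℕ m) → Vec ℕ m → ℚ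
  newtonPolynomial L e = ∑ₗ L (λ f → newtonCoeff f e)

  private
    toℚ-newtonSum : ∀ {m} (L : List (Vec ℕ m)) z → ∑ₗ L (λ f → toℚ (newton f z)) ≡ toℚ (newtonSum L z)
    toℚ-newtonSum []      z = refl
    toℚ-newtonSum (f ∷ L) z = trans (cong (toℚ (newton f z) +_) (toℚ-newtonSum L z)) (sym (toℚ-+ (newton f z) _))

  eval-newtonPolynomial : ∀ m D (L : List (Vec ℕ m)) → All (λ f → sumV f ≤ D) L → (z : Fin m → ℕ) →
                          eval (newtonPolynomial L) D (toℚ ∘ z) ≡ toℚ (newtonSum L z)
  eval-newtonPolynomial m D L L≤D z = begin
    ∑ₗ (exps m D) (λ e → newtonPolynomial L e * monomial e x)
      ≡⟨ ∑ₗ-cong (exps m D) (All.universal (λ e → *-distribʳ-∑ₗ L (λ f → newtonCoeff f e) (monomial e x)) _) ⟩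
    ∑ₗ (exps m D) (λ e → ∑ₗ L (λ f → newtonCoeff f e * monomial e x))
      ≡⟨ ∑ₗ-comm (exps m D) L (λ e f → newtonCoeff f e * monomial e x) ⟩
    ∑ₗ L (λ f → ∑ₗ (exps m D) (λ e → newtonCoeff f e * monomial e x))
      ≡⟨ ∑ₗ-cong L (All.map (λ {f} f≤D → newton-expansion m D f f≤D z) L≤D) ⟩
    ∑ₗ L (λ f → toℚ (newton f z))
      ≡⟨ toℚ-newtonSum L z ⟩
    toℚ (newtonSum L z)
      ∎
    where
    open ≡-Reasoning
    x = toℚ ∘ z

  private
    some-coordinate-below : ∀ {m} (f e : Vec ℕ m) → sumV f ≤ sumV e → f ≢ e → ∃ λ a → lookup f a < lookup e a
    some-coordinate-below []       []       _   f≢e = ⊥-elim (f≢e refl)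
    some-coordinate-below (f₀ ∷ f) (e₀ ∷ e) f≤e f≢e with f₀ ℕ.<? e₀
    ... | yes f₀<e₀ = zero , f₀<e₀
    ... | no  f₀≮e₀ with Vec.≡-dec ℕ._≟_ f e
    ...   | yes refl = ⊥-elim (f≢e (cong (_∷ f) (ℕ.≤-antisym (ℕ.+-cancelʳ-≤ (sumV f) f₀ e₀ f≤e) (ℕ.≮⇒≥ f₀≮e₀))))
    ...   | no  f≢e′ =
      let f≤e′ = ℕ.+-cancelˡ-≤ e₀ _ _ (ℕ.≤-trans (ℕ.+-monoˡ-≤ (sumV f) (ℕ.≮⇒≥ f₀≮e₀)) f≤e)
          a , fa<ea = some-coordinate-below f e f≤e′ f≢e′
      in suc a , fa<ea

  newtonCoeff-vanish : ∀ {m} (f e : Vec ℕ m) → sumV f ≤ sumV e → f ≢ e → newtonCoeff f e ≡ 0ℚ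
  newtonCoeff-vanish f e f≤e f≢e =
    let a , fa<ea = some-coordinate-below f e f≤e f≢e
    in ∏ⱽ-zero _ a (binomialCoeff-vanish (lookup f a) (lookup e a) fa<ea)

  multiplicity : ∀ {m} → Vec ℕ m → List (Vec ℕ m) → ℕ
  multiplicity g []      = 0
  multiplicity g (f ∷ L) with Vec.≡-dec ℕ._≟_ f g
  ... | yes _ = suc (multiplicity g L)
  ... | no  _ = multiplicity g L

  multiplicity-∈ : ∀ {m} {g : Vec ℕ m} {L} → g ∈ L → ∃ λ k → multiplicity g L ≡ suc k
  multiplicity-∈ {g = g} {f ∷ L} g∈L with Vec.≡-dec ℕ._≟_ f g | g∈L
  ... | yes _   | _          = multiplicity g L , refl
  ... | no  f≢g | here g≡f   = ⊥-elim (f≢g (sym g≡f))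
  ... | no  _   | there g∈L′ = multiplicity-∈ g∈L′

  newtonPolynomial-diagonal : ∀ {m} (g : Vec ℕ m) L → All (λ f → sumV f ≤ sumV g) L →
                              newtonPolynomial L g ≡ toℚ (multiplicity g L) * newtonCoeff g g
  newtonPolynomial-diagonal g []      []          = sym (ℚ.*-zeroˡ (newtonCoeff g g))
  newtonPolynomial-diagonal g (f ∷ L) (f≤g ∷ L≤g) with Vec.≡-dec ℕ._≟_ f g
  ... | yes refl = begin
    newtonCoeff f f + newtonPolynomial L f
      ≡⟨ cong (newtonCoeff f f +_) (newtonPolynomial-diagonal f L L≤g) ⟩
    newtonCoeff f f + toℚ (multiplicity f L) * newtonCoeff f f
      ≡⟨ solve 2 (λ c k → c :+ k :* c := (con 1ℚ :+ k) :* c) refl (newtonCoeff f f) (toℚ (multiplicity f L)) ⟩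
    (1ℚ + toℚ (multiplicity f L)) * newtonCoeff f f
      ≡⟨ cong (_* newtonCoeff f f) (toℚ-+ 1 (multiplicity f L)) ⟨
    toℚ (suc (multiplicity f L)) * newtonCoeff f f
      ∎
    where open ≡-Reasoning
  ... | no  f≢g  = trans (cong₂ _+_ (newtonCoeff-vanish f g f≤g f≢g) (newtonPolynomial-diagonal g L L≤g)) (ℚ.+-identityˡ _)

  newtonPolynomial-hasDegree : ∀ {m} D (L : List (Vec ℕ m)) → All (λ f → sumV f ≤ D) L → Any (λ f → sumV f ≡ D) L →
                               HasDegree (newtonPolynomial L) D
  newtonPolynomial-hasDegree D L L≤D top = vanishes-above , (g , |g|≡D , leading≢0)
    where
    vanishes-above : ∀ e → D < sumV e → newtonPolynomial L e ≡ 0ℚ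
    vanishes-above e D<e = ∑ₗ-zero L (All.map (λ {f} f≤D → newtonCoeff-vanish f e (ℕ.≤-trans f≤D (ℕ.<⇒≤ D<e))
                                                             (λ { refl → ℕ.<⇒≱ D<e f≤D })) L≤D)
    found = find top
    g = proj₁ found
    g∈L = proj₁ (proj₂ found)
    |g|≡D = proj₂ (proj₂ found)
    k = proj₁ (multiplicity-∈ g∈L)
    leading : newtonPolynomial L g ≡ toℚ (suc k) * newtonCoeff g g
    leading = trans (newtonPolynomial-diagonal g L (All.map (λ f≤D → ℕ.≤-trans f≤D (ℕ.≤-reflexive (sym |g|≡D))) L≤D))
                    (cong (λ k → toℚ k * newtonCoeff g g) (proj₂ (multiplicity-∈ g∈L)))
    leading≢0 : newtonPolynomial L g ≢ 0ℚ
    leading≢0 = subst (_≢ 0ℚ) (sym leading) (*-≢0 (toℚ-suc≢0 k) (∏ⱽ-≢0 _ (λ a → binomialCoeff-leading (lookup g a))))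

  eval-cong : ∀ {m} (c : Vec ℕ m → ℚ) D {x y : Fin m → ℚ} → (∀ a → x a ≡ y a) → eval c D x ≡ eval c D y
  eval-cong {m} c D x≗y = ∑ₗ-cong (exps m D) (All.universal (λ e → cong (λ t → c e * t)
    (cong (Vec.foldr _ _*_ 1ℚ) (Vec.tabulate-cong (λ a → cong (λ w → powℚ w (lookup e a)) (x≗y a))))) _)

module PhiList where

  open import Data.Nat.Base as ℕ using (ℕ; zero; suc; _≤_; _<_; z≤n; s≤s; _<ᵇ_; _≤ᵇ_)
  import Data.Nat.Properties as ℕ
  open import Data.Nat.ListAction using (sum)
  open import Data.Bool.Base using (Bool; T; _∧_)
  open import Data.Bool.Properties using (T-∧)
  open import Data.Bool.ListAction using (any)
  open import Data.Fin.Base as Fin using (Fin)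
  import Data.Fin.Properties as Fin
  open import Data.Vec.Base using (Vec)
  open import Data.List.Base as List using (List; []; _∷_; take; length; upTo; map; allFin)
  import Data.List.Properties as List
  open import Data.List.Relation.Unary.All as All using (All; []; _∷_)
  import Data.List.Relation.Unary.All.Properties as All
  open import Data.List.Relation.Unary.Any as Any using (Any; here)
  import Data.List.Relation.Unary.Any.Properties as Any
  open import Data.List.Relation.Unary.AllPairs using (AllPairs)
  import Data.List.Relation.Unary.AllPairs.Properties as AllPairs
  open import Data.List.Membership.Propositional using (_∈_)
  import Data.List.Membership.Propositional.Properties as ∈
  open import Data.Product.Base using (∃; _×_; _,_; proj₂)
  open import Data.Sum.Base using (inj₁; inj₂)
  open import Function.Base using (_∘_; id)
  open import Function.Bundles using (Equivalence)
  open import Relation.Nullary using (¬_)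
  open import Relation.Nullary.Decidable using (T?)
  open import Relation.Binary.PropositionalEquality
  open import Relation.Binary.Core using (Rel)
  open import Level using (0ℓ)
  open import Data.Product.Relation.Binary.Lex.Strict using (×-Lex; ×-transitive)
  open import Defs using (r; inΦ; allPairs; Φ)

  prefixSum : List ℕ → ℕ → ℕ
  prefixSum ℓ k = sum (take k ℓ)

  prefixSum-mono : ∀ ℓ {k k′} → k ≤ k′ → prefixSum ℓ k ≤ prefixSum ℓ k′
  prefixSum-mono ℓ       {zero}  _         = z≤n
  prefixSum-mono []      {suc k} {suc k′} _ = z≤n
  prefixSum-mono (x ∷ ℓ) {suc k} {suc k′} (s≤s k≤k′) = ℕ.+-monoʳ-≤ x (prefixSum-mono ℓ k≤k′)

  prefixSum-full : ∀ ℓ k → length ℓ ≤ k → prefixSum ℓ k ≡ sum ℓ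
  prefixSum-full ℓ k len≤k = cong sum (List.take-all k ℓ len≤k)

  prefixSum-strict : ∀ ℓ k → All (0 <_) ℓ → k < length ℓ → prefixSum ℓ k < prefixSum ℓ (suc k)
  prefixSum-strict (x ∷ ℓ) zero    (0<x ∷ _)  _         = subst (0 <_) (sym (ℕ.+-identityʳ x)) 0<x
  prefixSum-strict (x ∷ ℓ) (suc k) (_ ∷ pos) (s≤s k<ℓ) = ℕ.+-monoʳ-< x (prefixSum-strict ℓ k pos k<ℓ)

  module _ {p} (η : Vec ℕ p) where

    Boundary : ℕ → ℕ → ℕ → Set
    Boundary a b k = a < r η k × r η k ≤ b

    boundaryᵇ : ℕ → ℕ → ℕ → Bool
    boundaryᵇ a b k = (a <ᵇ r η k) ∧ (r η k ≤ᵇ b)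

    separatedᵇ : ℕ → ℕ → Bool
    separatedᵇ a b = any (boundaryᵇ a b) (upTo (suc p))

    separatedᵇ⁻ : ∀ a b → T (separatedᵇ a b) → ∃ λ k → k ≤ p × Boundary a b k
    separatedᵇ⁻ a b sep =
      let k , k<1+p , both = Any.applyUpTo⁻ {P = T ∘ boundaryᵇ a b} id (Any.any⁻ (boundaryᵇ a b) (upTo (suc p)) sep)
          a<ᵇ , ≤ᵇb = Equivalence.to T-∧ both
      in k , ℕ.≤-pred k<1+p , ℕ.<ᵇ⇒< a (r η k) a<ᵇ , ℕ.≤ᵇ⇒≤ (r η k) b ≤ᵇb

    separatedᵇ⁺ : ∀ a b k → k ≤ p → Boundary a b k → T (separatedᵇ a b)
    separatedᵇ⁺ a b k k≤p (a<rk , rk≤b) =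
      Any.any⁺ (boundaryᵇ a b)
               (Any.applyUpTo⁺ {P = T ∘ boundaryᵇ a b} id (Equivalence.from T-∧ (ℕ.<⇒<ᵇ a<rk , ℕ.≤⇒≤ᵇ rk≤b)) (s≤s k≤p))

  _<ˡ_ : ∀ {n} → Rel (Fin n × Fin n) 0ℓ
  _<ˡ_ = ×-Lex _≡_ Fin._<_ Fin._<_

  <ˡ-irrefl : ∀ {n} (x : Fin n × Fin n) → ¬ x <ˡ x
  <ˡ-irrefl x (inj₁ i<i)       = ℕ.<-irrefl refl i<i
  <ˡ-irrefl x (inj₂ (_ , j<j)) = ℕ.<-irrefl refl j<j

  <ˡ-trans : ∀ {n} {x y z : Fin n × Fin n} → x <ˡ y → y <ˡ z → x <ˡ z
  <ˡ-trans {n} {x} {y} {z} = ×-transitive {_<₂_ = Fin._<_} isEquivalence (resp₂ Fin._<_) (Fin.<-trans {n = n}) (Fin.<-trans {n = n}) {x} {y} {z}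

  allPairs-sorted : ∀ n → AllPairs _<ˡ_ (allPairs n)
  allPairs-sorted n = AllPairs.concat⁺ (All.map⁺ (All.tabulate⁺ λ i → row-sorted))
                                       (AllPairs.map⁺ (AllPairs.tabulate⁺-< λ i<i′ → All.map⁺ (All.tabulate⁺ λ _ → rows-ordered i<i′)))
    where
    row-sorted : ∀ {i} → AllPairs _<ˡ_ (map (i ,_) (List.allFin n))
    row-sorted = AllPairs.map⁺ (AllPairs.tabulate⁺-< (λ j<j′ → inj₂ (refl , j<j′)))
    rows-ordered : ∀ {i i′ j} → i Fin.< i′ → All ((i , j) <ˡ_) (map (i′ ,_) (List.allFin n))
    rows-ordered i<i′ = All.map⁺ (All.tabulate⁺ (λ _ → inj₁ i<i′))

  ∈-allPairs : ∀ n (x : Fin n × Fin n) → x ∈ allPairs n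
  ∈-allPairs n (i , j) = ∈.∈-concatMap⁺ (λ i → map (i ,_) (allFin n))
                           (Any.map (λ { refl → ∈.∈-map⁺ (i ,_) (∈.∈-allFin j) }) (∈.∈-allFin i))

  module _ {p} (η : Vec ℕ p) (n : ℕ) where

    Φ-sorted : AllPairs _<ˡ_ (Φ η n)
    Φ-sorted = AllPairs.filter⁺ (T? ∘ λ { (i , j) → inΦ η i j }) (allPairs-sorted n)

    ∈Φ⁺ : ∀ i j → T (inΦ η i j) → (i , j) ∈ Φ η n
    ∈Φ⁺ i j inΦ-ij = ∈.∈-filter⁺ (T? ∘ λ { (i , j) → inΦ η i j }) (∈-allPairs n (i , j)) inΦ-ij

    ∈Φ⁻ : ∀ i j → (i , j) ∈ Φ η n → T (inΦ η i j)
    ∈Φ⁻ i j ij∈Φ = proj₂ (∈.∈-filter⁻ (T? ∘ λ { (i , j) → inΦ η i j }) {xs = allPairs n} ij∈Φ)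

module Composition (q n′ : ℕ) (η : Vec ℕ (suc (suc (suc q)))) (pos : ∀ i → 0 < lookup η i) (η-sum : Vec.sum η ≡ suc n′) where
  open import Data.Nat.Base as ℕ using (ℕ; zero; suc; _≤_; _<_; z≤n)
  open import Data.Vec.Base as Vec using (Vec; lookup; toList)
  open import Relation.Binary.PropositionalEquality using (_≡_)

  import Data.Nat.Properties as ℕ
  open import Data.Nat.ListAction using (sum)
  open import Data.Fin.Base as Fin using (Fin; toℕ; fromℕ)
  import Data.Fin.Properties as Fin
  import Data.Vec.Properties as Vec
  open import Data.List.Base using (List; []; _∷_; length)
  open import Data.List.Relation.Unary.All as All using (All; []; _∷_)
  open import Data.List.Relation.Unary.Any as Any using (Any; here; there)
  open import Data.List.Relation.Unary.AllPairs using (AllPairs; []; _∷_)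
  open import Data.List.Membership.Propositional using (_∈_; find)
  open import Data.Product.Base using (∃; _×_; _,_; proj₁; proj₂)
  open import Data.Sum.Base using (inj₁; inj₂)
  open import Data.Unit.Base using (tt)
  open import Data.Fin.Subset using (⁅_⁆)
  import Data.Fin.Subset as Subset
  import Data.Fin.Subset.Properties as Subset
  open import Data.Bool.Base using (true; false; if_then_else_; T)
  open import Data.Empty using (⊥-elim)
  open import Function.Base using (_∘_)
  open import Data.Vec.Functional.Properties using (updateAt-updates; updateAt-minimal)
  open import Relation.Nullary using (¬_; yes; no)
  open import Relation.Binary.PropositionalEquality
  open import Defs using (r; Φ; sumℤ; Y; Y⁺)
  open import Data.Integer.Base as ℤ using (ℤ; +_)
  import Data.Integer.Properties as ℤ
  open Flows using (module ℤΣ)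
  open Flows using (Edges; _∈ₛ_)
  open PhiList

  p : ℕ
  p = suc (suc (suc q))

  R S : ℕ
  R = r η (suc q)
  S = r η (suc (suc q))

  private
    ℓ = toList η

    length-ℓ : length ℓ ≡ p
    length-ℓ = Vec.length-toList η

    sum-toList : ∀ {m} (v : Vec ℕ m) → sum (toList v) ≡ Vec.sum v
    sum-toList Vec.[]       = refl
    sum-toList (x Vec.∷ v) = cong (x ℕ.+_) (sum-toList v)

    toList-pos : ∀ {m} (v : Vec ℕ m) → (∀ i → 0 < lookup v i) → All (0 <_) (toList v)
    toList-pos Vec.[]       _   = []
    toList-pos (x Vec.∷ v) pos = pos Fin.zero ∷ toList-pos v (pos ∘ Fin.suc)

  r-full : ∀ k → p ≤ k → r η k ≡ suc n′
  r-full k p≤k = trans (prefixSum-full ℓ k (subst (_≤ k) (sym length-ℓ) p≤k)) (trans (sum-toList η) η-sum)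

  R≤S : R ≤ S
  R≤S = prefixSum-mono ℓ (ℕ.n≤1+n (suc q))

  S≤n′ : S ≤ n′
  S≤n′ = ℕ.≤-pred (subst (S <_) (r-full p ℕ.≤-refl)
                          (prefixSum-strict ℓ (suc (suc q)) (toList-pos η pos) (subst (suc (suc q) <_) (sym length-ℓ) ℕ.≤-refl)))

  below-S : ∀ k → r η k < S → k ≤ suc q
  below-S k rk<S with k ℕ.≤? suc q
  ... | yes k≤ = k≤
  ... | no  k≰ = ⊥-elim (ℕ.<⇒≱ rk<S (prefixSum-mono ℓ (ℕ.≰⇒> k≰)))

  open FlowCounting n′ R S R≤S S≤n′ public

  boundary : ∀ {i j} → (i , j) ∈ Φ η n → ∃ λ k → k ≤ p × Boundary η (toℕ i) (toℕ j) k
  boundary {i} {j} ij∈Φ = separatedᵇ⁻ η (toℕ i) (toℕ j) (∈Φ⁻ η n i j ij∈Φ)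

  toℕ-sink : toℕ sink ≡ n′
  toℕ-sink = Fin.toℕ-fromℕ n′

  to-sink∈Φ : ∀ {v} k → k ≤ p → toℕ v < r η k → r η k ≤ n′ → (v , sink) ∈ Φ η n
  to-sink∈Φ {v} k k≤p v<rk rk≤n′ =
    ∈Φ⁺ η n v sink (separatedᵇ⁺ η (toℕ v) (toℕ sink) k k≤p (v<rk , subst (r η k ≤_) (sym toℕ-sink) rk≤n′))

  source-below-S : ∀ {v b} → (v , b) ∈ Φ η n → toℕ v < S
  source-below-S {v} {b} vb∈Φ with boundary vb∈Φ
  ... | k , k≤p , v<rk , rk≤b with k ℕ.≤? suc (suc q)
  ...   | yes k≤ = ℕ.<-≤-trans v<rk (prefixSum-mono ℓ k≤)
  ...   | no  k≰ = ⊥-elim (ℕ.<-irrefl refl (ℕ.<-≤-trans (Fin.toℕ<n b) (subst (_≤ toℕ b) (r-full k (ℕ.≰⇒> k≰)) rk≤b)))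

  -- x ∷ E is a final segment of the lexicographically sorted list Φ η n.
  record Suffix (x : Fin n × Fin n) (E : Edges n) : Set where
    field
      head∈Φ     : x ∈ Φ η n
      tail⊆Φ     : ∀ {y} → y ∈ E → y ∈ Φ η n
      above-head : All (x <ˡ_) E
      above⊆tail : ∀ {y} → y ∈ Φ η n → x <ˡ y → y ∈ E

  private
    ∈⇒∈ₛ : ∀ {a b} {E : Edges n} → (a , b) ∈ E → a ∈ₛ E
    ∈⇒∈ₛ = Any.map (λ eq → cong proj₁ (sym eq))

  suffix-facts : ∀ {i j E} → Suffix (i , j) E → EdgeFacts i j E
  suffix-facts {i} {j} {E} suffix = record
    { forward      = i<j
    ; source-fresh = All.tabulate (λ {e} e∈E → target≢i e (All.lookup above-head e∈E) (tail⊆Φ e∈E))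
    ; inner        = λ j<S → i∈E (ℕ.<-≤-trans j<S S≤n′)
                           , ∈⇒∈ₛ (above⊆tail (to-sink∈Φ (suc (suc q)) (ℕ.n≤1+n _) j<S S≤n′) (inj₁ i<j))
                           , ℕ.<-≤-trans i<rk (prefixSum-mono ℓ (below-S k (ℕ.≤-<-trans rk≤j j<S)))
    ; dead-end     = λ S≤j j<n′ → i∈E j<n′ , λ j∈E →
                       let e , e∈E , e₁≡j = find j∈E in ℕ.<⇒≱ (source-at e e∈E e₁≡j) S≤j
    ; into-sink    = λ j≡sink i∈E → let e , e∈E , e₁≡i = find i∈E in
                       not-after-sink e (All.lookup above-head e∈E) e₁≡i j≡sink
    }
    where
    open Suffix suffix
    K = boundary head∈Φ
    k = proj₁ K
    k≤p = proj₁ (proj₂ K)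
    i<rk = proj₁ (proj₂ (proj₂ K))
    rk≤j = proj₂ (proj₂ (proj₂ K))
    i<j = ℕ.<-≤-trans i<rk rk≤j
    i∈E : toℕ j < n′ → i ∈ₛ E
    i∈E j<n′ = ∈⇒∈ₛ (above⊆tail (to-sink∈Φ k k≤p i<rk (ℕ.≤-trans rk≤j (ℕ.<⇒≤ j<n′)))
                               (inj₂ (refl , subst (toℕ j <_) (sym toℕ-sink) j<n′)))
    target≢i : ∀ e → (i , j) <ˡ e → e ∈ Φ η n → proj₂ e ≢ i
    target≢i (a , b) ij<ab ab∈Φ refl with boundary ab∈Φ
    ... | _ , _ , a<rk′ , rk′≤b = ℕ.<-irrefl refl (ℕ.<-≤-trans (ℕ.<-≤-trans a<rk′ rk′≤b) (i≤a ij<ab))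
      where
      i≤a : (i , j) <ˡ (a , i) → toℕ i ≤ toℕ a
      i≤a (inj₁ i<a)        = ℕ.<⇒≤ i<a
      i≤a (inj₂ (refl , _)) = ℕ.≤-refl
    source-at : ∀ e → e ∈ E → proj₁ e ≡ j → toℕ j < S
    source-at (a , b) e∈E refl = source-below-S (tail⊆Φ e∈E)
    not-after-sink : ∀ e → (i , j) <ˡ e → proj₁ e ≡ i → j ≢ sink
    not-after-sink (a , b) (inj₁ i<i)       refl _    = ℕ.<-irrefl refl i<i
    not-after-sink (a , b) (inj₂ (_ , j<b)) _    refl = ℕ.<⇒≱ j<b (subst (toℕ b ≤_) (sym toℕ-sink) (ℕ.≤-pred (Fin.toℕ<n b)))

  suffix-next : ∀ {x y E} → Suffix x (y ∷ E) → All (y <ˡ_) E → Suffix y E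
  suffix-next {x} {y} {E} suffix y<E = record
    { head∈Φ     = tail⊆Φ (here refl)
    ; tail⊆Φ     = tail⊆Φ ∘ there
    ; above-head = y<E
    ; above⊆tail = λ z∈Φ y<z → later z∈Φ y<z (above⊆tail z∈Φ (<ˡ-trans (All.lookup above-head (here refl)) y<z))
    }
    where
    open Suffix suffix
    later : ∀ {z} → z ∈ Φ η n → y <ˡ z → z ∈ y ∷ E → z ∈ E
    later _ y<z (here refl) = ⊥-elim (<ˡ-irrefl _ y<z)
    later _ _   (there z∈E) = z∈E

  suffix-admissible : ∀ {i j E} → Suffix (i , j) E → AllPairs _<ˡ_ E → Admissible ((i , j) ∷ E)
  suffix-admissible suffix []             = suffix-facts suffix , tt
  suffix-admissible suffix (y<E ∷ sorted) = suffix-facts suffix , suffix-admissible (suffix-next suffix y<E) sorted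

  private
    enumeration-admissible : ∀ L → AllPairs _<ˡ_ L → (∀ {y} → y ∈ L → y ∈ Φ η n) → (∀ {y} → y ∈ Φ η n → y ∈ L) →
                             Admissible L
    enumeration-admissible []            _              _    _    = tt
    enumeration-admissible ((i , j) ∷ E) (ij<E ∷ sorted) L⊆Φ Φ⊆L = suffix-admissible suffix sorted
      where
      suffix : Suffix (i , j) E
      suffix = record
        { head∈Φ     = L⊆Φ (here refl)
        ; tail⊆Φ     = L⊆Φ ∘ there
        ; above-head = ij<E
        ; above⊆tail = λ y∈Φ ij<y → above (Φ⊆L y∈Φ) ij<y
        }
        where
        above : ∀ {y} → y ∈ (i , j) ∷ E → (i , j) <ˡ y → y ∈ E
        above (here refl) ij<ij = ⊥-elim (<ˡ-irrefl _ ij<ij)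
        above (there y∈E) _     = y∈E

  Φ-admissible : Admissible (Φ η n)
  Φ-admissible = enumeration-admissible (Φ η n) (Φ-sorted η n) (λ y∈Φ → y∈Φ) (λ y∈Φ → y∈Φ)

  idle⇒last-block : ∀ v → ¬ v ∈ₛ Φ η n → S ≤ toℕ v
  idle⇒last-block v v∉Φ with toℕ v ℕ.<? S
  ... | yes v<S = ⊥-elim (v∉Φ (∈⇒∈ₛ (to-sink∈Φ (suc (suc q)) (ℕ.n≤1+n _) v<S S≤n′)))
  ... | no  v≮S = ℕ.≮⇒≥ v≮S

  private
    sumℤ≡sum : ∀ {m} (f : Fin m → ℤ) → sumℤ f ≡ ℤΣ.sum f
    sumℤ≡sum {zero}  f = refl
    sumℤ≡sum {suc m} f = cong (ℤ._+_ (f Fin.zero)) (sumℤ≡sum (f ∘ Fin.suc))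

    sum-nonneg : ∀ {m} (t : Fin m → ℤ) → (∀ v → + 0 ℤ.≤ t v) → + 0 ℤ.≤ ℤΣ.sum t
    sum-nonneg {zero}  t _     = ℤ.+≤+ z≤n
    sum-nonneg {suc m} t t≥0 = ℤ.+-mono-≤ (t≥0 Fin.zero) (sum-nonneg (t ∘ Fin.suc) (t≥0 ∘ Fin.suc))

    term≤sum : ∀ {m} (t : Fin m → ℤ) → (∀ v → + 0 ℤ.≤ t v) → ∀ v → t v ℤ.≤ ℤΣ.sum t
    term≤sum t t≥0 Fin.zero    = ℤ.≤-trans (ℤ.≤-reflexive (sym (ℤ.+-identityʳ (t Fin.zero))))
                                           (ℤ.+-monoʳ-≤ (t Fin.zero) (sum-nonneg (t ∘ Fin.suc) (t≥0 ∘ Fin.suc)))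
    term≤sum t t≥0 (Fin.suc v) = ℤ.≤-trans (term≤sum (t ∘ Fin.suc) (t≥0 ∘ Fin.suc) v)
                                           (ℤ.≤-trans (ℤ.≤-reflexive (sym (ℤ.+-identityˡ _))) (ℤ.+-monoˡ-≤ _ (t≥0 Fin.zero)))

  private
    lookup-⁅⁆-self : ∀ {m} (y : Fin m) → lookup ⁅ y ⁆ y ≡ true
    lookup-⁅⁆-self Fin.zero    = refl
    lookup-⁅⁆-self (Fin.suc y) = lookup-⁅⁆-self y

    lookup-⁅⁆-≢ : ∀ {m} {a y : Fin m} → a ≢ y → lookup ⁅ y ⁆ a ≡ false
    lookup-⁅⁆-≢ {a = Fin.zero}  {Fin.zero}  a≢y = ⊥-elim (a≢y refl)
    lookup-⁅⁆-≢ {a = Fin.suc a} {Fin.zero}  _   = Vec.lookup-replicate a false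
    lookup-⁅⁆-≢ {a = Fin.zero}  {Fin.suc y} _   = refl
    lookup-⁅⁆-≢ {a = Fin.suc a} {Fin.suc y} a≢y = lookup-⁅⁆-≢ (a≢y ∘ cong Fin.suc)

  module _ (γ : Vec ℤ n) (y⁺ : Y⁺ η γ) where
    private
      g = lookup γ
      nonneg : ∀ v → toℕ v < n′ → + 0 ℤ.≤ g v
      nonneg = proj₂ (proj₂ y⁺)
      balanced : ℤΣ.sum g ≡ + 0
      balanced = trans (sym (sumℤ≡sum g)) (proj₁ (proj₁ y⁺))

      A D : Fin n → ℤ
      A v = if toℕ v ℕ.<ᵇ S then g v else + 0
      D v = if toℕ v ℕ.<ᵇ S then + 0 else g v

      A+D : ∀ v → A v ℤ.+ D v ≡ g v
      A+D v with toℕ v ℕ.<ᵇ S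
      ... | true  = ℤ.+-identityʳ (g v)
      ... | false = ℤ.+-identityˡ (g v)

      D-sink : D sink ≡ g sink
      D-sink with toℕ sink ℕ.<ᵇ S in eq
      ... | false = refl
      ... | true  = ⊥-elim (ℕ.<⇒≱ (ℕ.<ᵇ⇒< (toℕ sink) S (subst T (sym eq) tt)) (subst (S ≤_) (sym toℕ-sink) S≤n′))

      prefix+sink≥0 : + 0 ℤ.≤ ℤΣ.sum A ℤ.+ g sink
      prefix+sink≥0 = subst (λ s → + 0 ℤ.≤ ℤΣ.sum A ℤ.+ s) (trans (sumℤ≡sum C) (trans (ℤΣ.sum-single C sink C-off) C-sink))
                            (subst (λ s → + 0 ℤ.≤ s ℤ.+ sumℤ C) (sumℤ≡sum A) last-block-condition)
        where
        C : Fin n → ℤ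
        C v = if lookup ⁅ sink ⁆ v then g v else + 0
        C-off : ∀ v → v ≢ sink → C v ≡ + 0
        C-off v v≢sink rewrite lookup-⁅⁆-≢ v≢sink = refl
        in-last-block : ∀ v → v Subset.∈ ⁅ sink ⁆ → S ≤ toℕ v × toℕ v < r η p
        in-last-block v v∈ with Subset.x∈⁅y⁆⇒x≡y sink v∈
        ... | refl = subst (S ≤_) (sym toℕ-sink) S≤n′ , subst₂ _<_ (sym toℕ-sink) (sym (r-full p ℕ.≤-refl)) ℕ.≤-refl
        C-sink : C sink ≡ g sink
        C-sink rewrite lookup-⁅⁆-self sink = refl
        last-block-condition = proj₂ (proj₁ y⁺) (suc (suc q)) ℕ.≤-refl ⁅ sink ⁆ in-last-block

      rest : Fin n → ℤ
      rest = ℤΣ.without sink D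

      rest-nonneg : ∀ v → + 0 ℤ.≤ rest v
      rest-nonneg v with v Fin.≟ sink
      ... | yes refl   = ℤ.≤-reflexive (sym (updateAt-updates sink D))
      ... | no  v≢sink = subst (+ 0 ℤ.≤_) (sym (updateAt-minimal v sink D v≢sink)) (D-nonneg (toℕ v ℕ.<ᵇ S))
        where
        D-nonneg : ∀ b → + 0 ℤ.≤ (if b then + 0 else g v)
        D-nonneg true  = ℤ.≤-refl
        D-nonneg false = nonneg v (≢sink⇒<n′ v≢sink)

      sum-rest≤0 : ℤΣ.sum rest ℤ.≤ + 0
      sum-rest≤0 = subst (ℤ._≤ + 0) (sym (cancel total≡0)) (ℤ.neg-mono-≤ prefix+sink≥0)
        where
        total≡0 : (ℤΣ.sum A ℤ.+ g sink) ℤ.+ ℤΣ.sum rest ≡ + 0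
        total≡0 = begin
          (ℤΣ.sum A ℤ.+ g sink) ℤ.+ ℤΣ.sum rest   ≡⟨ ℤ.+-assoc (ℤΣ.sum A) (g sink) _ ⟩
          ℤΣ.sum A ℤ.+ (g sink ℤ.+ ℤΣ.sum rest)   ≡⟨ cong (λ d → ℤΣ.sum A ℤ.+ (d ℤ.+ ℤΣ.sum rest)) D-sink ⟨
          ℤΣ.sum A ℤ.+ (D sink ℤ.+ ℤΣ.sum rest)   ≡⟨ cong (ℤ._+_ (ℤΣ.sum A)) (ℤΣ.sum-without sink D) ⟨
          ℤΣ.sum A ℤ.+ ℤΣ.sum D                   ≡⟨ ℤΣ.∑-distrib-+ A D ⟨
          ℤΣ.sum (λ v → A v ℤ.+ D v)              ≡⟨ ℤΣ.sum-cong-≗ A+D ⟩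
          ℤΣ.sum g                                ≡⟨ balanced ⟩
          + 0                                     ∎
          where open ≡-Reasoning
        cancel : ∀ {x y} → x ℤ.+ y ≡ + 0 → y ≡ ℤ.- x
        cancel {x} {y} x+y≡0 = begin
          y                       ≡⟨ ℤ.+-identityˡ y ⟨
          + 0 ℤ.+ y               ≡⟨ cong (ℤ._+ y) (ℤ.+-inverseˡ x) ⟨
          (ℤ.- x ℤ.+ x) ℤ.+ y     ≡⟨ ℤ.+-assoc (ℤ.- x) x y ⟩
          ℤ.- x ℤ.+ (x ℤ.+ y)     ≡⟨ cong (ℤ._+_ (ℤ.- x)) x+y≡0 ⟩
          ℤ.- x ℤ.+ + 0           ≡⟨ ℤ.+-identityʳ (ℤ.- x) ⟩
          ℤ.- x                   ∎
          where open ≡-Reasoning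

    last-block-idle : ∀ v → S ≤ toℕ v → toℕ v < n′ → lookup γ v ≡ + 0
    last-block-idle v S≤v v<n′ =
      ℤ.≤-antisym (ℤ.≤-trans (ℤ.≤-reflexive (sym rest-v)) (ℤ.≤-trans (term≤sum rest rest-nonneg v) sum-rest≤0)) (nonneg v v<n′)
      where
      v≢sink = <n′⇒≢sink v<n′
      rest-v : rest v ≡ g v
      rest-v with toℕ v ℕ.<ᵇ S in eq
      ... | true  = ⊥-elim (ℕ.<⇒≱ (ℕ.<ᵇ⇒< (toℕ v) S (subst T (sym eq) tt)) S≤v)
      ... | false = trans (updateAt-minimal v sink D v≢sink) (cong (λ b → if b then + 0 else g v) eq)

    Y⁺⇒Invariant : Invariant (Φ η n) γ
    Y⁺⇒Invariant = record
      { nonneg   = nonneg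
      ; idle     = λ v v<n′ v∉Φ → last-block-idle v (idle⇒last-block v v∉Φ) v<n′
      ; balanced = balanced
      }

module DegreeCount (q n′ : ℕ) (η : Vec ℕ (suc (suc (suc q)))) (pos : ∀ i → 0 < lookup η i) (η-sum : Vec.sum η ≡ suc n′) where
  open import Data.Nat.Base as ℕ using (ℕ; zero; suc; _+_; _*_; _∸_; _≤_; _<_; z≤n)
  open import Data.Vec.Base as Vec using (Vec; lookup; toList)
  open import Relation.Binary.PropositionalEquality

  import Data.Nat.Properties as ℕ
  open import Data.Nat.ListAction using (sum)
  open import Data.Nat.ListAction.Properties using (sum-++)
  open import Data.Nat.Solver using (module +-*-Solver)
  open import Data.Bool.Base using (Bool; true; false; T; _∧_)
  open import Data.Fin.Base as Fin using (Fin; toℕ; inject≤)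
  import Data.Fin.Properties as Fin
  import Data.Vec.Properties as Vec
  open import Data.List.Base as List using (List; []; _∷_; _++_; map; concatMap; tabulate; filterᵇ; take; drop; length)
  import Data.List.Properties as List
  open import Data.Product.Base using (∃; _×_; _,_; proj₁; proj₂)
  open import Function.Base using (_∘_)
  open import Relation.Nullary using (¬_; yes; no; Dec)
  open import Relation.Nullary.Decidable using (⌊_⌋)
  open import Data.Bool.Properties using (∧-zeroʳ; ∧-identityʳ)
  open import Data.Unit.Base using (tt)
  open import Data.Empty using (⊥-elim)
  open import Defs using (r; inΦ; Φ; allPairs; pairSum; degree)
  open FinSum ℕ.+-0-commutativeMonoid using (sum-syntax; sum-cong-≗; sum-zero; sum-inject≤) renaming (sum to ∑)
  open PhiList
  open Composition q n′ η pos η-sum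
  open +-*-Solver

  private
    count-++ : ∀ {A : Set} (P : A → Bool) xs ys → count P (xs ++ ys) ≡ count P xs + count P ys
    count-++ P []       ys = refl
    count-++ P (x ∷ xs) ys = trans (cong (𝟙 (P x) +_) (count-++ P xs ys)) (sym (ℕ.+-assoc (𝟙 (P x)) _ _))

    count-filterᵇ : ∀ {A : Set} (P Q : A → Bool) xs → count Q (filterᵇ P xs) ≡ count (λ x → P x ∧ Q x) xs
    count-filterᵇ P Q []       = refl
    count-filterᵇ P Q (x ∷ xs) with P x
    ... | true  = cong (𝟙 (Q x) +_) (count-filterᵇ P Q xs)
    ... | false = count-filterᵇ P Q xs

    count-tabulate : ∀ {A : Set} {K} (P : A → Bool) (g : Fin K → A) → count P (tabulate g) ≡ ∑[ i < K ] 𝟙 (P (g i))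
    count-tabulate {K = zero}  P g = refl
    count-tabulate {K = suc K} P g = cong (𝟙 (P (g Fin.zero)) +_) (count-tabulate P (g ∘ Fin.suc))

    count-concatMap-tabulate : ∀ {A B : Set} {K} (P : B → Bool) (h : A → List B) (g : Fin K → A) →
                               count P (concatMap h (tabulate g)) ≡ ∑[ i < K ] count P (h (g i))
    count-concatMap-tabulate {K = zero}  P h g = refl
    count-concatMap-tabulate {K = suc K} P h g =
      trans (count-++ P (h (g Fin.zero)) _) (cong (count P (h (g Fin.zero)) +_) (count-concatMap-tabulate P h (g ∘ Fin.suc)))

  count-allPairs : ∀ (P : Fin n × Fin n → Bool) → count P (allPairs n) ≡ ∑[ i < n ] ∑[ j < n ] 𝟙 (P (i , j))
  count-allPairs P = trans (count-concatMap-tabulate P (λ i → map (i ,_) (List.allFin n)) (λ i → i))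
    (sum-cong-≗ {n} (λ i → trans (cong (count P) (List.map-tabulate (λ j → j) (i ,_))) (count-tabulate P (i ,_))))

  innerEdges-Φ : innerEdges (Φ η n) ≡ ∑[ i < n ] ∑[ j < n ] 𝟙 (inΦ η i j ∧ isInner (i , j))
  innerEdges-Φ = trans (count-filterᵇ _ isInner (allPairs n)) (count-allPairs (λ e → inΦ η (proj₁ e) (proj₂ e) ∧ isInner e))

  private
    <?-true : ∀ {a b} → a < b → ⌊ a ℕ.<? b ⌋ ≡ true
    <?-true {a} {b} a<b with a ℕ.<? b
    ... | yes _   = refl
    ... | no  a≮b = ⊥-elim (a≮b a<b)

    <?-false : ∀ {a b} → ¬ a < b → ⌊ a ℕ.<? b ⌋ ≡ false
    <?-false {a} {b} a≮b with a ℕ.<? b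
    ... | yes a<b = ⊥-elim (a≮b a<b)
    ... | no  _   = refl

    not-separated : ∀ {a b} → b < S → S ≤ a → separatedᵇ η a b ≡ false
    not-separated {a} {b} b<S S≤a with separatedᵇ η a b in eq
    ... | false = refl
    ... | true  = let k , _ , a<rk , rk≤b = separatedᵇ⁻ η a b (subst T (sym eq) tt) in
                  ⊥-elim (ℕ.<-irrefl refl (ℕ.<-≤-trans (ℕ.<-≤-trans a<rk rk≤b) (ℕ.≤-trans (ℕ.<⇒≤ b<S) S≤a)))

  inner-block : ∑[ i < n ] ∑[ j < n ] 𝟙 (inΦ η i j ∧ isInner (i , j)) ≡
                ∑[ a < S ] ∑[ b < S ] 𝟙 (separatedᵇ η (toℕ a) (toℕ b))
  inner-block = trans (sum-inject≤ S≤n (λ i → ∑[ j < n ] σ i j) outside-row)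
                      (sum-cong-≗ {S} λ a → trans (sum-inject≤ S≤n (σ (inject≤ a S≤n)) (outside-column (inject≤ a S≤n)))
                                                  (sum-cong-≗ {S} (inside a)))
    where
    S≤n = ℕ.m≤n⇒m≤1+n S≤n′
    σ : Fin n → Fin n → ℕ
    σ i j = 𝟙 (inΦ η i j ∧ isInner (i , j))
    outside-column : ∀ i j → S ≤ toℕ j → σ i j ≡ 0
    outside-column i j S≤j = trans (cong (λ t → 𝟙 (inΦ η i j ∧ t)) (<?-false (ℕ.≤⇒≯ S≤j))) (cong 𝟙 (∧-zeroʳ (inΦ η i j)))
    outside-row : ∀ i → S ≤ toℕ i → ∑[ j < n ] σ i j ≡ 0
    outside-row i S≤i = sum-zero (σ i) λ j → case-split j (toℕ j ℕ.<? S)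
      where
      case-split : ∀ j → Dec (toℕ j < S) → σ i j ≡ 0
      case-split j (yes j<S) = cong (λ t → 𝟙 (t ∧ isInner (i , j))) (not-separated j<S S≤i)
      case-split j (no  j≮S) = outside-column i j (ℕ.≮⇒≥ j≮S)
    inside : ∀ a b → σ (inject≤ a S≤n) (inject≤ b S≤n) ≡ 𝟙 (separatedᵇ η (toℕ a) (toℕ b))
    inside a b rewrite Fin.toℕ-inject≤ a S≤n | Fin.toℕ-inject≤ b S≤n | <?-true (Fin.toℕ<n b) =
      cong 𝟙 (∧-identityʳ (separatedᵇ η (toℕ a) (toℕ b)))

  private
    ∑-split : ∀ x N (f : ℕ → ℕ) → ∑[ i < x + N ] f (toℕ i) ≡ ∑[ i < x ] f (toℕ i) + ∑[ i < N ] f (x + toℕ i)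
    ∑-split zero    N f = refl
    ∑-split (suc x) N f = trans (cong (f 0 +_) (∑-split x N (f ∘ suc))) (sym (ℕ.+-assoc (f 0) _ _))

    ∑-const : ∀ K c → ∑[ i < K ] c ≡ K * c
    ∑-const zero    c = refl
    ∑-const (suc K) c = cong (c +_) (∑-const K c)

    𝟙-true : ∀ {b} → T b → 𝟙 b ≡ 1
    𝟙-true {true} _ = refl

    𝟙-false : ∀ {b} → ¬ T b → 𝟙 b ≡ 0
    𝟙-false {false} _  = refl
    𝟙-false {true}  ¬t = ⊥-elim (¬t tt)

  pairs-across-blocks : ∀ ℓ (Q : ℕ → ℕ → Bool) →
    (∀ {a b} → a < sum ℓ → b < sum ℓ → T (Q a b) → ∃ λ k → a < prefixSum ℓ k × prefixSum ℓ k ≤ b) →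
    (∀ {a b} k → a < sum ℓ → b < sum ℓ → a < prefixSum ℓ k → prefixSum ℓ k ≤ b → T (Q a b)) →
    ∑[ a < sum ℓ ] ∑[ b < sum ℓ ] 𝟙 (Q (toℕ a) (toℕ b)) ≡ pairSum ℓ
  pairs-across-blocks []      Q sound complete = refl
  pairs-across-blocks (x ∷ ℓ) Q sound complete = begin
    ∑[ a < x + N ] row (toℕ a)
      ≡⟨ ∑-split x N row ⟩
    ∑[ a < x ] row (toℕ a) + ∑[ c < N ] row (x + toℕ c)
      ≡⟨ cong₂ _+_ (trans (sum-cong-≗ {x} (λ a → first-block (Fin.toℕ<n a))) (∑-const x N))
                   (sum-cong-≗ {N} (λ c → later-block (Fin.toℕ<n c))) ⟩
    x * N + ∑[ c < N ] ∑[ d < N ] 𝟙 (Q (x + toℕ c) (x + toℕ d))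
      ≡⟨ cong (x * N +_) (pairs-across-blocks ℓ (λ c d → Q (x + c) (x + d)) sound′ complete′) ⟩
    x * N + pairSum ℓ
      ∎
    where
    open ≡-Reasoning
    N = sum ℓ
    row : ℕ → ℕ
    row a = ∑[ b < x + N ] 𝟙 (Q a (toℕ b))
    before-first-boundary : ∀ {a b} → a < x + N → b < x → 𝟙 (Q a b) ≡ 0
    before-first-boundary {a} {b} a<x+N b<x = 𝟙-false λ Qab → case (sound a<x+N (ℕ.<-≤-trans b<x (ℕ.m≤m+n x N)) Qab)
      where
      case : ¬ ∃ λ k → a < prefixSum (x ∷ ℓ) k × prefixSum (x ∷ ℓ) k ≤ b
      case (suc k , _ , x+rk≤b) = ℕ.<⇒≱ b<x (ℕ.≤-trans (ℕ.m≤m+n x _) x+rk≤b)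
    row-split : ∀ {a} → a < x + N → row a ≡ ∑[ d < N ] 𝟙 (Q a (x + toℕ d))
    row-split {a} a<x+N = begin
      row a
        ≡⟨ ∑-split x N (λ b → 𝟙 (Q a b)) ⟩
      ∑[ b < x ] 𝟙 (Q a (toℕ b)) + ∑[ d < N ] 𝟙 (Q a (x + toℕ d))
        ≡⟨ cong (_+ ∑[ d < N ] 𝟙 (Q a (x + toℕ d))) (sum-zero {x} _ (λ b → before-first-boundary a<x+N (Fin.toℕ<n b))) ⟩
      ∑[ d < N ] 𝟙 (Q a (x + toℕ d))
        ∎
    first-block : ∀ {a} → a < x → row a ≡ N
    first-block {a} a<x = begin
      row a                          ≡⟨ row-split a<x+N ⟩
      ∑[ d < N ] 𝟙 (Q a (x + toℕ d)) ≡⟨ sum-cong-≗ {N} (λ d → 𝟙-true (complete 1 a<x+N (ℕ.+-monoʳ-< x (Fin.toℕ<n d))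
                                                                       a<x+0 x+0≤x+d)) ⟩
      ∑[ d < N ] 1                   ≡⟨ trans (∑-const N 1) (ℕ.*-identityʳ N) ⟩
      N                              ∎
      where
      a<x+N = ℕ.<-≤-trans a<x (ℕ.m≤m+n x N)
      a<x+0 = subst (a <_) (sym (ℕ.+-identityʳ x)) a<x
      x+0≤x+d : ∀ {d} → x + 0 ≤ x + d
      x+0≤x+d = ℕ.+-monoʳ-≤ x z≤n
    later-block : ∀ {c} → c < N → row (x + c) ≡ ∑[ d < N ] 𝟙 (Q (x + c) (x + toℕ d))
    later-block c<N = row-split (ℕ.+-monoʳ-< x c<N)
    sound′ : ∀ {c d} → c < N → d < N → T (Q (x + c) (x + d)) → ∃ λ k → c < prefixSum ℓ k × prefixSum ℓ k ≤ d
    sound′ c<N d<N Q′ with sound (ℕ.+-monoʳ-< x c<N) (ℕ.+-monoʳ-< x d<N) Q′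
    ... | suc k , x+c<x+rk , x+rk≤x+d = k , ℕ.+-cancelˡ-< x _ _ x+c<x+rk , ℕ.+-cancelˡ-≤ x _ _ x+rk≤x+d
    complete′ : ∀ {c d} k → c < N → d < N → c < prefixSum ℓ k → prefixSum ℓ k ≤ d → T (Q (x + c) (x + d))
    complete′ k c<N d<N c<rk rk≤d =
      complete (suc k) (ℕ.+-monoʳ-< x c<N) (ℕ.+-monoʳ-< x d<N) (ℕ.+-monoʳ-< x c<rk) (ℕ.+-monoʳ-≤ x rk≤d)

  private
    pairSum-snoc : ∀ (xs : List ℕ) y → pairSum (xs ++ y ∷ []) ≡ pairSum xs + y * sum xs
    pairSum-snoc []       y = ℕ.+-identityʳ (y * 0)
    pairSum-snoc (x ∷ xs) y = begin
      x * sum (xs ++ y ∷ []) + pairSum (xs ++ y ∷ [])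
        ≡⟨ cong₂ (λ s t → x * s + t) (sum-++ xs (y ∷ [])) (pairSum-snoc xs y) ⟩
      x * (sum xs + (y + 0)) + (pairSum xs + y * sum xs)
        ≡⟨ solve 4 (λ x s y P → x :* (s :+ (y :+ con 0)) :+ (P :+ y :* s) := x :* s :+ P :+ y :* (x :+ s)) refl x (sum xs) y (pairSum xs) ⟩
      x * sum xs + pairSum xs + y * (x + sum xs)
        ∎
      where open ≡-Reasoning

    ℓ ℓ′ : List ℕ
    ℓ  = toList η
    ℓ′ = take (suc (suc q)) ℓ

    prefixSum-ℓ′ : ∀ k → prefixSum ℓ′ k ≡ r η (k ℕ.⊓ suc (suc q))
    prefixSum-ℓ′ k = cong sum (List.take-take k (suc (suc q)) ℓ)

    last-part : ∃ λ y → List.drop (suc (suc q)) ℓ ≡ y ∷ []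
    last-part with List.drop (suc (suc q)) ℓ
                 | trans (List.length-drop (suc (suc q)) ℓ) (trans (cong (_∸ suc (suc q)) (Vec.length-toList η)) (ℕ.m+n∸n≡m 1 q))
    ... | y ∷ [] | _ = y , refl

    pairSum-ℓ′ : pairSum ℓ′ ≡ degree η
    pairSum-ℓ′ = begin
      pairSum ℓ′                              ≡⟨ ℕ.m+n∸n≡m (pairSum ℓ′) (y * S) ⟨
      pairSum ℓ′ + y * S ∸ y * S              ≡⟨ cong₂ (λ P s → P ∸ y * s) (sym pairSum-ℓ) (sym r-last∸y) ⟩
      pairSum ℓ ∸ y * (r η p ∸ y)             ≡⟨ cong (λ t → pairSum ℓ ∸ t * (r η p ∸ t)) (sym ηp≡y) ⟩
      degree η                                ∎
      where
      open ≡-Reasoning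
      y = proj₁ last-part
      ℓ≡ : ℓ ≡ ℓ′ ++ y ∷ []
      ℓ≡ = trans (sym (List.take++drop≡id (suc (suc q)) ℓ)) (cong (ℓ′ ++_) (proj₂ last-part))
      r-last : r η p ≡ S + y
      r-last = begin
        r η p                  ≡⟨ prefixSum-full ℓ p (ℕ.≤-reflexive (Vec.length-toList η)) ⟩
        sum ℓ                  ≡⟨ cong sum ℓ≡ ⟩
        sum (ℓ′ ++ y ∷ [])     ≡⟨ sum-++ ℓ′ (y ∷ []) ⟩
        S + (y + 0)            ≡⟨ cong (S +_) (ℕ.+-identityʳ y) ⟩
        S + y                  ∎
      ηp≡y : r η p ∸ S ≡ y
      ηp≡y = trans (cong (_∸ S) r-last) (ℕ.m+n∸m≡n S y)
      r-last∸y : r η p ∸ y ≡ S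
      r-last∸y = trans (cong (_∸ y) r-last) (ℕ.m+n∸n≡m S y)
      pairSum-ℓ : pairSum ℓ ≡ pairSum ℓ′ + y * S
      pairSum-ℓ = trans (cong pairSum ℓ≡) (pairSum-snoc ℓ′ y)

  -- η_p (n − η_p) counts the pairs of Φ ending in the last block, so the degree counts the inner edges.
  innerEdges≡degree : innerEdges (Φ η n) ≡ degree η
  innerEdges≡degree = begin
    innerEdges (Φ η n)
      ≡⟨ innerEdges-Φ ⟩
    ∑[ i < n ] ∑[ j < n ] 𝟙 (inΦ η i j ∧ isInner (i , j))
      ≡⟨ inner-block ⟩
    ∑[ a < S ] ∑[ b < S ] 𝟙 (separatedᵇ η (toℕ a) (toℕ b))
      ≡⟨ pairs-across-blocks ℓ′ (separatedᵇ η) sound complete ⟩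
    pairSum ℓ′
      ≡⟨ pairSum-ℓ′ ⟩
    degree η
      ∎
    where
    open ≡-Reasoning
    sound : ∀ {a b} → a < S → b < S → T (separatedᵇ η a b) → ∃ λ k → a < prefixSum ℓ′ k × prefixSum ℓ′ k ≤ b
    sound {a} {b} a<S b<S sep =
      let k , _ , a<rk , rk≤b = separatedᵇ⁻ η a b sep
          rk≡ = trans (prefixSum-ℓ′ k) (cong (r η) (ℕ.m≤n⇒m⊓n≡m (ℕ.m≤n⇒m≤1+n (below-S k (ℕ.≤-<-trans rk≤b b<S)))))
      in k , subst (a <_) (sym rk≡) a<rk , subst (_≤ b) (sym rk≡) rk≤b
    complete : ∀ {a b} k → a < S → b < S → a < prefixSum ℓ′ k → prefixSum ℓ′ k ≤ b → T (separatedᵇ η a b)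
    complete {a} {b} k _ _ a<rk rk≤b =
      separatedᵇ⁺ η a b (k ℕ.⊓ suc (suc q)) (ℕ.≤-trans (ℕ.m⊓n≤n k _) (ℕ.n≤1+n _))
                  (subst (a <_) (prefixSum-ℓ′ k) a<rk , subst (_≤ b) (prefixSum-ℓ′ k) rk≤b)

module Restriction {R n : ℕ} (R≤n : R ≤ n) where
  open import Data.Nat.Base as ℕ using (ℕ; zero; suc; _≤_)

  import Data.Nat.Properties as ℕ
  open import Data.Nat.Combinatorics using (_C_)
  open import Data.Fin.Base using (Fin; toℕ; inject≤)
  open import Data.Vec.Base as Vec using (Vec; []; _∷_; lookup; tabulate)
  import Data.Vec.Properties as Vec
  open import Data.List.Base using (List; []; _∷_; map)
  open import Data.List.Relation.Unary.All using (All; []; _∷_)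
  open import Data.List.Relation.Unary.Any using (Any; here; there)
  open import Function.Base using (_∘_)
  open import Relation.Binary.PropositionalEquality
  open import Defs using (sumV)
  open NewtonBasis using (newton; newtonSum)
  open FinSum ℕ.+-0-commutativeMonoid using (sum; sum-inject≤)
  open FinSum ℕ.*-1-commutativeMonoid using () renaming (sum to ∏; sum-inject≤ to ∏-inject≤; sum-cong-≗ to ∏-cong-≗)

  embed : Fin R → Fin n
  embed a = inject≤ a R≤n

  restrict : Vec ℕ n → Vec ℕ R
  restrict f = tabulate (lookup f ∘ embed)

  Vanishing : Vec ℕ n → Set
  Vanishing f = ∀ v → R ≤ toℕ v → lookup f v ≡ 0

  private
    sumV-tabulate : ∀ {m} (h : Fin m → ℕ) → sumV (tabulate h) ≡ sum h
    sumV-tabulate {zero}  h = refl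
    sumV-tabulate {suc m} h = cong (h Fin.zero ℕ.+_) (sumV-tabulate (h ∘ Fin.suc))
      where import Data.Fin.Base as Fin

  sumV-restrict : ∀ f → Vanishing f → sumV (restrict f) ≡ sumV f
  sumV-restrict f vanish = begin
    sumV (restrict f)       ≡⟨ sumV-tabulate (lookup f ∘ embed) ⟩
    sum (lookup f ∘ embed)  ≡⟨ sum-inject≤ R≤n (lookup f) vanish ⟨
    sum (lookup f)          ≡⟨ sumV-tabulate (lookup f) ⟨
    sumV (tabulate (lookup f)) ≡⟨ cong sumV (Vec.tabulate∘lookup f) ⟩
    sumV f                  ∎
    where open ≡-Reasoning

  newton-restrict : ∀ f z → Vanishing f → newton (restrict f) (z ∘ embed) ≡ newton f z
  newton-restrict f z vanish = begin
    ∏ (λ a → z (embed a) C lookup (restrict f) a)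
      ≡⟨ ∏-cong-≗ (λ a → cong (z (embed a) C_) (Vec.lookup∘tabulate (lookup f ∘ embed) a)) ⟩
    ∏ (λ a → z (embed a) C lookup f (embed a))
      ≡⟨ ∏-inject≤ R≤n (λ v → z v C lookup f v) (λ v R≤v → cong (z v C_) (vanish v R≤v)) ⟨
    ∏ (λ v → z v C lookup f v)
      ∎
    where open ≡-Reasoning

  newtonSum-restrict : ∀ L z → All Vanishing L → newtonSum (map restrict L) (z ∘ embed) ≡ newtonSum L z
  newtonSum-restrict []      z []               = refl
  newtonSum-restrict (f ∷ L) z (vanish ∷ vanishes) = cong₂ ℕ._+_ (newton-restrict f z vanish) (newtonSum-restrict L z vanishes)

  All-restrict : ∀ {P : ℕ → Set} L → All Vanishing L → All (P ∘ sumV) L → All (P ∘ sumV) (map restrict L)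
  All-restrict         []      []                  []       = []
  All-restrict {P = P} (f ∷ L) (vanish ∷ vanishes) (p ∷ ps) = subst P (sym (sumV-restrict f vanish)) p ∷ All-restrict {P = P} L vanishes ps

  Any-restrict : ∀ {P : ℕ → Set} L → All Vanishing L → Any (P ∘ sumV) L → Any (P ∘ sumV) (map restrict L)
  Any-restrict {P = P} (f ∷ L) (vanish ∷ _)        (here p)  = here (subst P (sym (sumV-restrict f vanish)) p)
  Any-restrict {P = P} (f ∷ L) (_      ∷ vanishes) (there a) = there (Any-restrict {P = P} L vanishes a)

open import Data.Nat.Base as ℕ using (ℕ; zero; suc; _<_; _≤_; _∸_; s≤s)
import Data.Nat.Properties as ℕ
open import Data.Integer.Base as ℤ using (ℤ; +_; ∣_∣)
import Data.Integer.Properties as ℤ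
open import Data.Rational.Base using (ℚ; _/_)
open import Data.Fin.Base using (Fin; toℕ; fromℕ<)
import Data.Fin.Properties as Fin
open import Data.Vec.Base as Vec using (Vec; _∷_; lookup)
open import Data.List.Base using (map)
open import Data.List.Relation.Unary.All as All using (All)
open import Data.List.Relation.Unary.Any using (Any)
open import Data.Product.Base using (Σ-syntax; ∃-syntax; _×_; _,_)
open import Data.Sum.Base using (inj₁)
open import Data.Empty using (⊥-elim)
open import Function.Base using (_∘_)
open import Function.Bundles using (_↔_)
open import Relation.Nullary using (yes; no)
open import Relation.Binary.PropositionalEquality
open import Defs
open Flows using (flowCount; Flows↔Fin-flowCount)
open NewtonBasis using (newtonSum)
open BinomialPolynomial using (toℚ)
open MonomialExpansion using (newtonPolynomial; newtonPolynomial-hasDegree; eval-newtonPolynomial; eval-cong)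

coordℚ-toℚ : ∀ {n} (γ : Vec ℤ n) (v : Fin n) → + 0 ℤ.≤ lookup γ v → coordℚ γ (toℕ v) ≡ toℚ ∣ lookup γ v ∣
coordℚ-toℚ {n} γ v 0≤γv with toℕ v ℕ.<? n
... | yes v<n = trans (cong (λ w → lookup γ w / 1) (Fin.fromℕ<-toℕ v v<n)) (cong (_/ 1) (sym (ℤ.0≤i⇒+∣i∣≡i 0≤γv)))
... | no  v≮n = ⊥-elim (v≮n (Fin.toℕ<n v))

main : (q n′ : ℕ) (η : Vec ℕ (suc (suc (suc q)))) → (∀ i → 0 < lookup η i) → Vec.sum η ≡ suc n′ →
  Σ[ c ∈ (Vec ℕ (r η (suc q)) → ℚ) ]
    (HasDegree c (degree η) ×
     ((γ : Vec ℤ (suc n′)) → Y⁺ η γ →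
        ∃[ N ] ((KSet η γ ↔ Fin N) × (eval c (degree η) (λ a → coordℚ γ (toℕ a)) ≡ (+ N) / 1))))
main q n′ η pos η-sum = newtonPolynomial L′ , newtonPolynomial-hasDegree (degree η) L′ bounded reaches , counted
  where
  open Composition q n′ η pos η-sum
  open DegreeCount q n′ η pos η-sum using (innerEdges≡degree)
  R≤n = ℕ.≤-trans R≤S (ℕ.≤-trans S≤n′ (ℕ.n≤1+n n′))
  open Restriction R≤n
  L = newtonExponents (Φ η n)
  L′ = map restrict L
  vanishing : All Vanishing L
  vanishing = All.map (λ sup v R≤v → sup v (inj₁ R≤v)) (newtonExponents-supported (Φ η n) Φ-admissible)
  bounded : All (λ f → sumV f ≤ degree η) L′
  bounded = All-restrict {P = _≤ degree η} L vanishing (subst (λ D → All (λ f → sumV f ≤ D) L) innerEdges≡degree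
                                            (newtonExponents-bounded (Φ η n) Φ-admissible))
  reaches : Any (λ f → sumV f ≡ degree η) L′
  reaches = Any-restrict {P = _≡ degree η} L vanishing (subst (λ D → Any (λ f → sumV f ≡ D) L) innerEdges≡degree
                                            (newtonExponents-reaches (Φ η n) Φ-admissible))
  counted : (γ : Vec ℤ n) → Y⁺ η γ →
            ∃[ N ] ((KSet η γ ↔ Fin N) × (eval (newtonPolynomial L′) (degree η) (λ a → coordℚ γ (toℕ a)) ≡ (+ N) / 1))
  counted γ y⁺ = flowCount (Φ η n) γ , Flows↔Fin-flowCount (Φ η n) (Admissible⇒SourcesFirst (Φ η n) Φ-admissible) γ , (begin
    eval (newtonPolynomial L′) (degree η) (λ a → coordℚ γ (toℕ a))
      ≡⟨ eval-cong (newtonPolynomial L′) (degree η) coordinates ⟩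
    eval (newtonPolynomial L′) (degree η) (toℚ ∘ ∣ γ ∣ⱽ ∘ embed)
      ≡⟨ eval-newtonPolynomial R (degree η) L′ bounded (∣ γ ∣ⱽ ∘ embed) ⟩
    toℚ (newtonSum L′ (∣ γ ∣ⱽ ∘ embed))
      ≡⟨ cong toℚ (newtonSum-restrict L ∣ γ ∣ⱽ vanishing) ⟩
    toℚ (newtonSum L ∣ γ ∣ⱽ)
      ≡⟨ cong toℚ (flowCount≡newtonSum (Φ η n) Φ-admissible γ invariant) ⟨
    toℚ (flowCount (Φ η n) γ)
      ∎)
    where
    open ≡-Reasoning
    invariant = Y⁺⇒Invariant γ y⁺
    coordinates : ∀ a → coordℚ γ (toℕ a) ≡ toℚ (∣ γ ∣ⱽ (embed a))
    coordinates a = trans (cong (coordℚ γ) (sym (Fin.toℕ-inject≤ a R≤n)))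
                          (coordℚ-toℚ γ (embed a) (Invariant.nonneg invariant (embed a) embed<n′))
      where embed<n′ = subst (_< n′) (sym (Fin.toℕ-inject≤ a R≤n)) (ℕ.<-≤-trans (Fin.toℕ<n a) (ℕ.≤-trans R≤S S≤n′))

corollary3p24 : (n p : ℕ) (η : Vec ℕ p) → (∀ i → 0 < lookup η i) → Vec.sum η ≡ n → 3 ≤ p →
  Σ[ c ∈ (Vec ℕ (r η (p ∸ 2)) → ℚ) ]
    (HasDegree c (degree η) ×
     ((γ : Vec ℤ n) → Y⁺ η γ →
        ∃[ N ] ((KSet η γ ↔ Fin N) ×
                (eval c (degree η) (λ a → coordℚ γ (toℕ a)) ≡ (+ N) / 1))))
corollary3p24 (suc n′) (suc (suc (suc q))) η       pos η-sum _ = main q n′ η pos η-sum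
corollary3p24 zero     (suc (suc (suc q))) (x ∷ η) pos η-sum _ =
  ⊥-elim (ℕ.<⇒≢ (ℕ.<-≤-trans (pos Fin.zero) (ℕ.m≤m+n x (Vec.sum η))) (sym η-sum))
  where import Data.Fin.Base as Fin
corollary3p24 n (suc zero)       η pos η-sum (s≤s ())
corollary3p24 n (suc (suc zero)) η pos η-sum (s≤s (s≤s ()))
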